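{- Let $p$ be a depth-zero, bifix-free pattern of dimensions $a\times c$ with $a\ge 2$. For integers $n\ge 0$ and $m\ge n$, let $s_n(m)$ be the number of ballot paths from $(0,0)$ to $(n,m)$ avoiding $p$. Then $s_n(m)=s_n(x)|_{x=m}$, where $$s_n(x)=(x-n+1)\sum_{i=0}^{\lfloor n/(a-1)\rfloor}\frac{(-1)^i}{x-ci+1}\binom{n-(a-1)i}{i}\binom{x+n-(a+c-1)i}{n-(a-1)i},$$ and in particular the number of Dyck paths (ballot paths ending at $(n,n)$) avoiding $p$ is $$s_n(n)=\sum_{i=0}^{\lfloor n/(a-1)\rfloor}\frac{(-1)^i}{n-ci+1}\binom{n-(a-1)i}{i}\binom{2n-(a+c-1)i}{n-(a-1)i}.$$
   Context: Paths are words over $\{u,r\}$, $u$ = up step $(0,1)$, $r$ = right step $(1,0)$. A ballot path is a path starting at the origin that stays weakly above the line $y=x$ (every prefix has at least as many $u$'s as $r$'s). A pattern is a finite nonempty word $p$ over $\{u,r\}$; a path avoids $p$ if $p$ does not occur in it as a contiguous subword. If $p$ has $a$ letters $r$ and $c$ letters $u$, then $p$ has dimensions $a\times c$. A nonempty word $o$ is a bifix of $p$ if $p=op'$ and $p=p''o$ for some nonempty words $p',p''$; $p$ is bifix-free if it has no bifix. The reverse $\tilde p$ of $p$ is obtained by reading $p$ backwards and interchanging $u$ and $r$; $p$ is depth-zero if $\tilde p$ is a ballot path (equivalently, every suffix of $p$ has at least as many $r$'s as $u$'s). Binomial coefficients: $\binom{y}{k}=y(y-1)\cdots(y-k+1)/k!$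 for integers $k\ge0$ and $\binom{y}{k}=0$ for $k<0$; a summand is taken to be $0$ whenever one of its binomial coefficient factors is $0$. -}

module Defs where

open import Data.Nat as ℕ using (ℕ; zero; suc; _≤_; _∸_; _+_)
open import Data.Nat.DivMod as ℕD using ()
open import Data.Integer as ℤ using (ℤ; +_; -[1+_])
open import Data.Rational as ℚ using (ℚ; 0ℚ; 1ℚ)
open import Data.List using (List; []; _∷_; _++_; length; filter; inits; tails)
open import Data.List.Relation.Unary.All using (All; all?)
open import Data.List.Relation.Binary.Infix.Heterogeneous using (Infix)
open import Data.List.Relation.Binary.Infix.Heterogeneous.Properties using (infix?)
open import Data.Product using (Σ; _×_; _,_)
open import Data.Empty using (⊥)
open import Relation.Nullary using (¬_; Dec; yes; no)
open import Relation.Nullary.Decidable using (_×-dec_; ¬?)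
open import Relation.Binary.PropositionalEquality using (_≡_; refl)

data Step : Set where
  u r : Step           -- u = up step (0,1), r = right step (1,0)

_≟S_ : (x y : Step) → Dec (x ≡ y)
u ≟S u = yes refl
u ≟S r = no (λ ())
r ≟S u = no (λ ())
r ≟S r = yes refl

Word : Set
Word = List Step

#u : Word → ℕ
#u []       = 0
#u (u ∷ w)  = suc (#u w)
#u (r ∷ w)  = #u w

#r : Word → ℕ
#r []       = 0
#r (u ∷ w)  = #r w
#r (r ∷ w)  = suc (#r w)

Ballot : Word → Set
Ballot w = All (λ q → #r q ≤ #u q) (inits w)

EndsAt : ℕ → ℕ → Word → Set
EndsAt n m w = (#r w ≡ n) × (#u w ≡ m)

Occurs : Word → Word → Set
Occurs p w = Infix _≡_ p w

Avoids : Word → Word → Set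
Avoids p w = ¬ Occurs p w

words : ℕ → List Word
words zero    = [] ∷ []
words (suc k) = Data.List.map (u ∷_) (words k) ++ Data.List.map (r ∷_) (words k)
  where import Data.List

Counted : Word → ℕ → ℕ → Word → Set
Counted p n m w = Ballot w × EndsAt n m w × Avoids p w

counted? : (p : Word) (n m : ℕ) (w : Word) → Dec (Counted p n m w)
counted? p n m w =
  all? (λ q → #r q ℕ.≤? #u q) (inits w)
  ×-dec ((#r w ℕ.≟ n) ×-dec (#u w ℕ.≟ m))
  ×-dec ¬? (infix? _≟S_ p w)

-- s_n(m): number of ballot paths from (0,0) to (n,m) avoiding p
-- (every such path has exactly n + m steps)
s : Word → ℕ → ℕ → ℕ
s p n m = length (filter (counted? p n m) (words (n + m)))

NonEmpty : Word → Set
NonEmpty w = Σ Step λ x → Σ Word λ w' → w ≡ x ∷ w'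

IsBifix : Word → Word → Set
IsBifix o p = NonEmpty o ×
  (Σ Word λ p' → Σ Word λ p'' →
     NonEmpty p' × NonEmpty p'' × (p ≡ o ++ p') × (p ≡ p'' ++ o))

BifixFree : Word → Set
BifixFree p = ¬ (Σ Word λ o → IsBifix o p)

DepthZero : Word → Set
DepthZero p = All (λ q → #u q ≤ #r q) (tails p)

-- generalized binomial coefficient  binom y k = y(y-1)...(y-k+1)/k!
binom : ℤ → ℕ → ℚ
binom y zero    = 1ℚ
binom y (suc k) = binom y k ℚ.* ((y ℤ.- + k) ℚ./ suc k)

-- q / d, for an integer d; the value 0 is used for d = 0
-- (that case never arises in a summand that is not already 0)
divℤ : ℚ → ℤ → ℚ
divℤ q (+ zero)   = 0ℚ
divℤ q (+ suc k)  = q ℚ.* ((+ 1) ℚ./ suc k)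
divℤ q -[1+ k ]   = q ℚ.* (-[1+ 0 ] ℚ./ suc k)

-- ⌊ n / d ⌋  (d ≥ 1 in all uses)
floorDiv : ℕ → ℕ → ℕ
floorDiv n zero    = 0
floorDiv n (suc d) = n ℕD./ suc d

sumTo : ℕ → (ℕ → ℚ) → ℚ
sumTo zero    f = f 0
sumTo (suc N) f = sumTo N f ℚ.+ f (suc N)

sign : ℕ → ℚ
sign zero    = 1ℚ
sign (suc i) = ℚ.- sign i

-- summand (-1)^i / (y - c i + 1) * binom(n-(a-1)i, i) * binom(z - (a+c-1)i, n-(a-1)i),
-- taken to be 0 when one of the binomial factors is 0
summand : (a c n : ℕ) (y z : ℤ) (i : ℕ) → ℚ
summand a c n y z i with binom (+ (n ∸ (a ∸ 1) ℕ.* i)) i ℚ.≟ 0ℚ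
                       | binom (z ℤ.- + ((a + c ∸ 1) ℕ.* i)) (n ∸ (a ∸ 1) ℕ.* i) ℚ.≟ 0ℚ
... | yes _ | _     = 0ℚ
... | no _  | yes _ = 0ℚ
... | no _  | no _  =
  divℤ (sign i ℚ.* binom (+ (n ∸ (a ∸ 1) ℕ.* i)) i
               ℚ.* binom (z ℤ.- + ((a + c ∸ 1) ℕ.* i)) (n ∸ (a ∸ 1) ℕ.* i))
       (y ℤ.- + (c ℕ.* i) ℤ.+ + 1)

sFormula : (a c n m : ℕ) → ℚ
sFormula a c n m =
  ((+ m ℤ.- + n ℤ.+ + 1) ℚ./ 1) ℚ.*
  sumTo (floorDiv n (a ∸ 1)) (summand a c n (+ m) (+ m ℤ.+ + n))

dyckFormula : (a c n : ℕ) → ℚ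
dyckFormula a c n =
  sumTo (floorDiv n (a ∸ 1)) (summand a c n (+ n) (+ (n + n)))

-- Both sides are functions of the lattice point (n, m), n ≤ m, and both satisfy one recurrence
-- that determines such a function.  Removing the last step of a counted path to (n, m+1) gives a
-- counted path to (n, m) or to (n-1, m+1); conversely such an extension is counted unless it
-- creates an occurrence of p, which is then a suffix.  Since p is bifix-free and of depth zero, the
-- paths ending in such an occurrence are exactly the counted paths to (n-a, m+1-c) followed by p,
-- so that
--   s(n, m+1) + [a ≤ n] s(n-a, m+1-c) = s(n, m) + s(n-1, m+1),   s(0, 0) = 1,   s(m+1, m) = 0.
-- The formula satisfies the same recurrence term by term: with n = j + a i and m = l + c i its
-- i-th term is (-1)^i (m-n+1)/(l+1) · (i+j+l)!/(i! j! l!), and after dividing by this trinomial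
-- coefficient the recurrence becomes a polynomial identity.

module Submission where

open import Defs
open import Data.Nat using (ℕ; _≤_)
open import Data.Integer using (+_)
open import Data.Product using (_×_)
open import Data.Rational using (ℚ; _/_)
open import Relation.Binary.PropositionalEquality using (_≡_)

open import Data.Nat using (zero; suc; _+_; _*_; _∸_; _<_; _≤?_; z≤n; s≤s; _!; NonZero; ≢-nonZero⁻¹; >-nonZero; >-nonZero⁻¹)
open import Data.Nat.Properties
import Data.Nat.DivMod as DivMod
open import Data.Nat.Combinatorics using (_C_; nCk≡n!/k![n-k]!; k>n⇒nCk≡0; k![n∸k]!∣n!; nCn≡1)
import Data.Nat.Tactic.RingSolver as ℕ-Solver
open import Data.Integer as ℤ using (ℤ)
import Data.Integer.Properties as ℤP
import Data.Integer.Tactic.RingSolver as ℤ-Solver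
open import Data.Rational as Q using (0ℚ; 1ℚ)
import Data.Rational.Properties as QP
import Data.Rational.Unnormalised as ℚᵘ
import Data.Rational.Unnormalised.Properties as ℚᵘP
open import Data.Rational.Solver using (module +-*-Solver)
open +-*-Solver using (solve; _:=_; _:+_; _:*_; _:-_; :-_; con)
open import Data.List using (List; []; _∷_; _++_; _∷ʳ_; length; filter; map; inits; take; drop; initLast; _∷ʳ′_)
import Data.List.Properties as List
open import Data.List.Relation.Unary.All as All using (All; []; _∷_)
import Data.List.Relation.Unary.All.Properties as All
open import Data.List.Relation.Binary.Infix.Heterogeneous using (here; toView; fromView; MkView)
open import Data.List.Relation.Binary.Pointwise using (Pointwise-≡⇒≡; ≡⇒Pointwise-≡)
open import Data.Product using (∃-syntax; _,_; proj₁; proj₂)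
open import Data.Sum using (_⊎_; inj₁; inj₂; [_,_]′)
open import Data.Empty using (⊥)
open import Function using (_∘_)
open import Relation.Nullary using (¬_; Dec; yes; no; contradiction; _×-dec_; map′)
open import Relation.Binary.PropositionalEquality
  using (_≢_; refl; sym; trans; cong; cong₂; subst; subst₂; module ≡-Reasoning)

ι : ℤ → ℚ
ι z = z / 1

ιₙ : ℕ → ℚ
ιₙ n = ι (+ n)

1/suc : ℕ → ℚ
1/suc d = + 1 / suc d

private
  toℚᵘ-/ : ∀ z d → Q.toℚᵘ (z / suc d) ℚᵘ.≃ ℚᵘ.mkℚᵘ z d
  toℚᵘ-/ z d = QP.toℚᵘ-fromℚᵘ (ℚᵘ.mkℚᵘ z d)

  toℚᵘ-ι : ∀ z → Q.toℚᵘ (ι z) ℚᵘ.≃ ℚᵘ.mkℚᵘ z 0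
  toℚᵘ-ι z = toℚᵘ-/ z 0

  +-on-representatives : ∀ x y → (x ℤ.* + 1 ℤ.+ y ℤ.* + 1) ℤ.* + 1 ≡ (x ℤ.+ y) ℤ.* (+ 1 ℤ.* + 1)
  +-on-representatives = ℤ-Solver.solve-∀

  *-on-representatives : ∀ x y → (x ℤ.* y) ℤ.* + 1 ≡ (x ℤ.* y) ℤ.* (+ 1 ℤ.* + 1)
  *-on-representatives = ℤ-Solver.solve-∀

  /-on-representatives : ∀ z e → (z ℤ.* + 1) ℤ.* e ≡ z ℤ.* (+ 1 ℤ.* e)
  /-on-representatives = ℤ-Solver.solve-∀

  inverse-on-representatives : ∀ e → (e ℤ.* + 1) ℤ.* + 1 ≡ + 1 ℤ.* (+ 1 ℤ.* e)
  inverse-on-representatives = ℤ-Solver.solve-∀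

module _ where
  open ℚᵘP.≃-Reasoning

  ι-+ : ∀ x y → ι (x ℤ.+ y) ≡ ι x Q.+ ι y
  ι-+ x y = QP.toℚᵘ-injective (begin
    Q.toℚᵘ (ι (x ℤ.+ y))            ≈⟨ toℚᵘ-ι (x ℤ.+ y) ⟩
    ℚᵘ.mkℚᵘ (x ℤ.+ y) 0             ≈⟨ ℚᵘ.*≡* (+-on-representatives x y) ⟨
    ℚᵘ.mkℚᵘ x 0 ℚᵘ.+ ℚᵘ.mkℚᵘ y 0    ≈⟨ ℚᵘP.+-cong (toℚᵘ-ι x) (toℚᵘ-ι y) ⟨
    Q.toℚᵘ (ι x) ℚᵘ.+ Q.toℚᵘ (ι y)  ≈⟨ QP.toℚᵘ-homo-+ (ι x) (ι y) ⟨
    Q.toℚᵘ (ι x Q.+ ι y)            ∎)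

  ι-* : ∀ x y → ι (x ℤ.* y) ≡ ι x Q.* ι y
  ι-* x y = QP.toℚᵘ-injective (begin
    Q.toℚᵘ (ι (x ℤ.* y))            ≈⟨ toℚᵘ-ι (x ℤ.* y) ⟩
    ℚᵘ.mkℚᵘ (x ℤ.* y) 0             ≈⟨ ℚᵘ.*≡* (*-on-representatives x y) ⟨
    ℚᵘ.mkℚᵘ x 0 ℚᵘ.* ℚᵘ.mkℚᵘ y 0    ≈⟨ ℚᵘP.*-cong (toℚᵘ-ι x) (toℚᵘ-ι y) ⟨
    Q.toℚᵘ (ι x) ℚᵘ.* Q.toℚᵘ (ι y)  ≈⟨ QP.toℚᵘ-homo-* (ι x) (ι y) ⟨
    Q.toℚᵘ (ι x Q.* ι y)            ∎)

  /suc≡*1/suc : ∀ z d → z / suc d ≡ ι z Q.* 1/suc d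
  /suc≡*1/suc z d = QP.toℚᵘ-injective (begin
    Q.toℚᵘ (z / suc d)                       ≈⟨ toℚᵘ-/ z d ⟩
    ℚᵘ.mkℚᵘ z d                              ≈⟨ ℚᵘ.*≡* (/-on-representatives z (+ suc d)) ⟨
    ℚᵘ.mkℚᵘ z 0 ℚᵘ.* ℚᵘ.mkℚᵘ (+ 1) d         ≈⟨ ℚᵘP.*-cong (toℚᵘ-ι z) (toℚᵘ-/ (+ 1) d) ⟨
    Q.toℚᵘ (ι z) ℚᵘ.* Q.toℚᵘ (1/suc d)       ≈⟨ QP.toℚᵘ-homo-* (ι z) (1/suc d) ⟨
    Q.toℚᵘ (ι z Q.* 1/suc d)                 ∎)

  ιₙ-suc-*-1/suc : ∀ d → ιₙ (suc d) Q.* 1/suc d ≡ 1ℚ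
  ιₙ-suc-*-1/suc d = QP.toℚᵘ-injective (begin
    Q.toℚᵘ (ιₙ (suc d) Q.* 1/suc d)              ≈⟨ QP.toℚᵘ-homo-* (ιₙ (suc d)) (1/suc d) ⟩
    Q.toℚᵘ (ιₙ (suc d)) ℚᵘ.* Q.toℚᵘ (1/suc d)    ≈⟨ ℚᵘP.*-cong (toℚᵘ-ι (+ suc d)) (toℚᵘ-/ (+ 1) d) ⟩
    ℚᵘ.mkℚᵘ (+ suc d) 0 ℚᵘ.* ℚᵘ.mkℚᵘ (+ 1) d     ≈⟨ ℚᵘ.*≡* (inverse-on-representatives (+ suc d)) ⟩
    Q.toℚᵘ 1ℚ                                    ∎)

open ≡-Reasoning

ι-injective : ∀ {x y} → ι x ≡ ι y → x ≡ y
ι-injective {x} {y} ιx≡ιy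
  with ℚᵘP.≃-trans (ℚᵘP.≃-sym (toℚᵘ-ι x)) (ℚᵘP.≃-trans (QP.toℚᵘ-cong ιx≡ιy) (toℚᵘ-ι y))
... | ℚᵘ.*≡* x*1≡y*1 = trans (sym (ℤP.*-identityʳ x)) (trans x*1≡y*1 (ℤP.*-identityʳ y))

ιₙ-+ : ∀ x y → ιₙ (x + y) ≡ ιₙ x Q.+ ιₙ y
ιₙ-+ x y = ι-+ (+ x) (+ y)

ιₙ-* : ∀ x y → ιₙ (x * y) ≡ ιₙ x Q.* ιₙ y
ιₙ-* x y = trans (cong ι (ℤP.pos-* x y)) (ι-* (+ x) (+ y))

ιₙ-injective : ∀ {m n} → ιₙ m ≡ ιₙ n → m ≡ n
ιₙ-injective eq = ℤP.+-injective (ι-injective eq)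

*-ιₙ-suc-cancelʳ : ∀ {x y} d → x Q.* ιₙ (suc d) ≡ y Q.* ιₙ (suc d) → x ≡ y
*-ιₙ-suc-cancelʳ {x} {y} d eq = begin
  x                                ≡⟨ QP.*-identityʳ x ⟨
  x Q.* 1ℚ                         ≡⟨ cong (x Q.*_) (ιₙ-suc-*-1/suc d) ⟨
  x Q.* (ιₙ (suc d) Q.* 1/suc d)   ≡⟨ QP.*-assoc x _ _ ⟨
  x Q.* ιₙ (suc d) Q.* 1/suc d     ≡⟨ cong (Q._* 1/suc d) eq ⟩
  y Q.* ιₙ (suc d) Q.* 1/suc d     ≡⟨ QP.*-assoc y _ _ ⟩
  y Q.* (ιₙ (suc d) Q.* 1/suc d)   ≡⟨ cong (y Q.*_) (ιₙ-suc-*-1/suc d) ⟩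
  y Q.* 1ℚ                         ≡⟨ QP.*-identityʳ y ⟩
  y                                ∎

*-1/suc-cross : ∀ {A B} l → A Q.* ιₙ (suc l) ≡ B Q.* ιₙ (suc (suc l)) → A Q.* 1/suc (suc l) ≡ B Q.* 1/suc l
*-1/suc-cross {A} {B} l AL≡BL′ = begin
  A Q.* J′
    ≡⟨ QP.*-identityʳ _ ⟨
  A Q.* J′ Q.* 1ℚ
    ≡⟨ cong (A Q.* J′ Q.*_) (ιₙ-suc-*-1/suc l) ⟨
  A Q.* J′ Q.* (ιₙ (suc l) Q.* J)
    ≡⟨ solve 4 (λ A J′ L J → A :* J′ :* (L :* J) := A :* L :* (J′ :* J)) refl A J′ (ιₙ (suc l)) J ⟩
  A Q.* ιₙ (suc l) Q.* (J′ Q.* J)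
    ≡⟨ cong (Q._* (J′ Q.* J)) AL≡BL′ ⟩
  B Q.* ιₙ (suc (suc l)) Q.* (J′ Q.* J)
    ≡⟨ solve 4 (λ B L′ J′ J → B :* L′ :* (J′ :* J) := B :* J :* (L′ :* J′)) refl B (ιₙ (suc (suc l))) J′ J ⟩
  B Q.* J Q.* (ιₙ (suc (suc l)) Q.* J′)
    ≡⟨ cong (B Q.* J Q.*_) (ιₙ-suc-*-1/suc (suc l)) ⟩
  B Q.* J Q.* 1ℚ
    ≡⟨ QP.*-identityʳ _ ⟩
  B Q.* J
    ∎
  where
  J = 1/suc l
  J′ = 1/suc (suc l)

ℚ-+-cancelʳ : ∀ {x y} z → x Q.+ z ≡ y Q.+ z → x ≡ y
ℚ-+-cancelʳ {x} {y} z = GroupProperties.∙-cancelʳ z x y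
  where import Algebra.Properties.Group QP.+-0-group as GroupProperties

sumTo-cong : ∀ N {f g} → (∀ i → f i ≡ g i) → sumTo N f ≡ sumTo N g
sumTo-cong zero    f≗g = f≗g 0
sumTo-cong (suc N) f≗g = cong₂ Q._+_ (sumTo-cong N f≗g) (f≗g (suc N))

sumTo-zero : ∀ N {f} → (∀ i → f i ≡ 0ℚ) → sumTo N f ≡ 0ℚ
sumTo-zero zero    f≡0 = f≡0 0
sumTo-zero (suc N) f≡0 = cong₂ Q._+_ (sumTo-zero N f≡0) (f≡0 (suc N))

*-distribˡ-sumTo : ∀ x N f → x Q.* sumTo N f ≡ sumTo N (λ i → x Q.* f i)
*-distribˡ-sumTo x zero    f = refl
*-distribˡ-sumTo x (suc N) f =
  trans (QP.*-distribˡ-+ x (sumTo N f) (f (suc N))) (cong (Q._+ x Q.* f (suc N)) (*-distribˡ-sumTo x N f))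

sumTo-+ : ∀ N f g → sumTo N (λ i → f i Q.+ g i) ≡ sumTo N f Q.+ sumTo N g
sumTo-+ zero    f g = refl
sumTo-+ (suc N) f g = begin
  sumTo N (λ i → f i Q.+ g i) Q.+ (f (suc N) Q.+ g (suc N))    ≡⟨ cong (Q._+ (f (suc N) Q.+ g (suc N))) (sumTo-+ N f g) ⟩
  (sumTo N f Q.+ sumTo N g) Q.+ (f (suc N) Q.+ g (suc N))      ≡⟨ solve 4 (λ A B C D → (A :+ B) :+ (C :+ D) := (A :+ C) :+ (B :+ D)) refl
                                                                       (sumTo N f) (sumTo N g) (f (suc N)) (g (suc N)) ⟩
  (sumTo N f Q.+ f (suc N)) Q.+ (sumTo N g Q.+ g (suc N))      ∎

sumTo-extend : ∀ N f → (∀ i → N < i → f i ≡ 0ℚ) → ∀ K → N ≤ K → sumTo K f ≡ sumTo N f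
sumTo-extend N f vanish K N≤K with m≤n⇒m<n∨m≡n N≤K
... | inj₂ refl = refl
... | inj₁ N<K@(s≤s {n = K′} N≤K′) = begin
  sumTo K′ f Q.+ f (suc K′)   ≡⟨ cong₂ Q._+_ (sumTo-extend N f vanish K′ N≤K′) (vanish (suc K′) N<K) ⟩
  sumTo N f Q.+ 0ℚ            ≡⟨ QP.+-identityʳ _ ⟩
  sumTo N f                   ∎

sumTo-suc-shift : ∀ N f g → f 0 ≡ 0ℚ → (∀ i → f (suc i) ≡ g i) → sumTo (suc N) f ≡ sumTo N g
sumTo-suc-shift zero    f g f0≡0 shift = trans (cong₂ Q._+_ f0≡0 (shift 0)) (QP.+-identityˡ _)
sumTo-suc-shift (suc N) f g f0≡0 shift = cong₂ Q._+_ (sumTo-suc-shift N f g f0≡0 shift) (shift (suc N))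

-- Binomial and trinomial coefficients

C-*-factorials : ∀ {n k} → k ≤ n → (n C k) * (k ! * (n ∸ k) !) ≡ n !
C-*-factorials {n} {k} k≤n = begin
  (n C k) * (k ! * (n ∸ k) !)                      ≡⟨ cong (_* (k ! * (n ∸ k) !)) (nCk≡n!/k![n-k]! k≤n) ⟩
  (n ! DivMod./ (k ! * (n ∸ k) !)) * (k ! * (n ∸ k) !) ≡⟨ DivMod.m/n*n≡m (k![n∸k]!∣n! k≤n) ⟩
  n !                                            ∎
  where instance _ = k !* (n ∸ k) !≢0

C-+-*-factorials : ∀ i j → ((i + j) C i) * (i ! * j !) ≡ (i + j) !
C-+-*-factorials i j =
  subst (λ x → ((i + j) C i) * (i ! * x !) ≡ (i + j) !) (m+n∸m≡n i j) (C-*-factorials (m≤m+n i j))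

C-+≢0 : ∀ i j → (i + j) C i ≢ 0
C-+≢0 i j C≡0 = ≢-nonZero⁻¹ ((i + j) !) {{(i + j) !≢0}} (begin
  (i + j) !                  ≡⟨ C-+-*-factorials i j ⟨
  ((i + j) C i) * (i ! * j !)  ≡⟨ cong (_* (i ! * j !)) C≡0 ⟩
  0                          ∎)

C-absorption : ∀ K i → (K C suc i) * suc i ≡ (K C i) * (K ∸ i)
C-absorption K i with ≤-<-connex K i
... | inj₁ K≤i = begin
  (K C suc i) * suc i    ≡⟨ cong (_* suc i) (k>n⇒nCk≡0 (s≤s K≤i)) ⟩
  0                      ≡⟨ *-zeroʳ (K C i) ⟨
  (K C i) * 0            ≡⟨ cong ((K C i) *_) (m≤n⇒m∸n≡0 K≤i) ⟨
  (K C i) * (K ∸ i)      ∎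
... | inj₂ i<K = *-cancelʳ-≡ _ _ (i ! * j !) {{i !* j !≢0}} (begin
  (K C suc i) * suc i * (i ! * j !)    ≡⟨ regroup (K C suc i) (suc i) (i !) (j !) ⟩
  (K C suc i) * (suc i ! * j !)        ≡⟨ C-*-factorials i<K ⟩
  K !                                ≡⟨ C-*-factorials (<⇒≤ i<K) ⟨
  (K C i) * (i ! * (K ∸ i) !)          ≡⟨ cong (λ x → (K C i) * (i ! * x !)) K∸i≡1+j ⟩
  (K C i) * (i ! * suc j !)            ≡⟨ regroup′ (K C i) (suc j) (i !) (j !) ⟩
  (K C i) * suc j * (i ! * j !)        ≡⟨ cong (λ x → (K C i) * x * (i ! * j !)) K∸i≡1+j ⟨
  (K C i) * (K ∸ i) * (i ! * j !)      ∎)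
  where
  j = K ∸ suc i
  K∸i≡1+j : K ∸ i ≡ suc j
  K∸i≡1+j = +-∸-assoc 1 i<K
  regroup : ∀ x y z w → x * y * (z * w) ≡ x * (y * z * w)
  regroup = ℕ-Solver.solve-∀
  regroup′ : ∀ x y z w → x * (z * (y * w)) ≡ x * y * (z * w)
  regroup′ = ℕ-Solver.solve-∀

trinomial : ℕ → ℕ → ℕ → ℕ
trinomial i j l = ((i + j) C i) * ((i + j + l) C (i + j))

trinomial-*-factorials : ∀ i j l → trinomial i j l * (i ! * j ! * l !) ≡ (i + j + l) !
trinomial-*-factorials i j l = begin
  (A * B) * (i ! * j ! * l !)        ≡⟨ regroup A B (i ! * j !) (l !) ⟩
  B * ((A * (i ! * j !)) * l !)      ≡⟨ cong (λ x → B * (x * l !)) (C-+-*-factorials i j) ⟩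
  B * ((i + j) ! * l !)              ≡⟨ C-+-*-factorials (i + j) l ⟩
  (i + j + l) !                      ∎
  where
  A = (i + j) C i
  B = (i + j + l) C (i + j)
  regroup : ∀ a b x y → (a * b) * (x * y) ≡ b * ((a * x) * y)
  regroup = ℕ-Solver.solve-∀

-- Adding one letter multiplies the multinomial coefficient by (new length)/(new multiplicity).
private
  quotient-step : ∀ x y k D N {M} .{{_ : NonZero (k * D)}} → M ≡ suc N →
                  x * D ≡ N ! → y * (k * D) ≡ M ! → M * x ≡ k * y
  quotient-step x y k D N refl xD≡N! yD′≡M! = *-cancelʳ-≡ _ _ (k * D) (begin
    suc N * x * (k * D)      ≡⟨ regroup (suc N) x k D ⟩
    k * (suc N * (x * D))    ≡⟨ cong (λ z → k * (suc N * z)) xD≡N! ⟩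
    k * suc N !              ≡⟨ cong (k *_) yD′≡M! ⟨
    k * (y * (k * D))        ≡⟨ *-assoc k y (k * D) ⟨
    k * y * (k * D)          ∎)
    where
    regroup : ∀ n x k d → n * x * (k * d) ≡ k * (n * (x * d))
    regroup = ℕ-Solver.solve-∀

  factorials≢0 : ∀ k i j l → NonZero (suc k * (i ! * j ! * l !))
  factorials≢0 k i j l = m*n≢0 (suc k) _ {{_}} {{m*n≢0 (i ! * j !) (l !) {{i !* j !≢0}} {{l !≢0}}}}

trinomial-sucˡ : ∀ i j l → (suc i + j + l) * trinomial i j l ≡ suc i * trinomial (suc i) j l
trinomial-sucˡ i j l =
  quotient-step (trinomial i j l) (trinomial (suc i) j l) (suc i) (i ! * j ! * l !) (i + j + l) {{factorials≢0 i i j l}}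
    refl (trinomial-*-factorials i j l)
    (trans (cong (trinomial (suc i) j l *_) (regroup (suc i) (i !) (j !) (l !))) (trinomial-*-factorials (suc i) j l))
  where
  regroup : ∀ k a b c → k * (a * b * c) ≡ k * a * b * c
  regroup = ℕ-Solver.solve-∀

trinomial-sucᵐ : ∀ i j l → (i + suc j + l) * trinomial i j l ≡ suc j * trinomial i (suc j) l
trinomial-sucᵐ i j l =
  quotient-step (trinomial i j l) (trinomial i (suc j) l) (suc j) (i ! * j ! * l !) (i + j + l) {{factorials≢0 j i j l}}
    (cong (_+ l) (+-suc i j)) (trinomial-*-factorials i j l)
    (trans (cong (trinomial i (suc j) l *_) (regroup (suc j) (i !) (j !) (l !))) (trinomial-*-factorials i (suc j) l))
  where
  regroup : ∀ k a b c → k * (a * b * c) ≡ a * (k * b) * c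
  regroup = ℕ-Solver.solve-∀

trinomial-sucʳ : ∀ i j l → (i + j + suc l) * trinomial i j l ≡ suc l * trinomial i j (suc l)
trinomial-sucʳ i j l =
  quotient-step (trinomial i j l) (trinomial i j (suc l)) (suc l) (i ! * j ! * l !) (i + j + l) {{factorials≢0 l i j l}}
    (+-suc (i + j) l) (trinomial-*-factorials i j l)
    (trans (cong (trinomial i j (suc l) *_) (regroup (suc l) (i !) (j !) (l !))) (trinomial-*-factorials i j (suc l)))
  where
  regroup : ∀ k a b c → k * (a * b * c) ≡ a * b * (k * c)
  regroup = ℕ-Solver.solve-∀

trinomial-zero : ∀ k → trinomial k 0 0 ≡ 1
trinomial-zero k rewrite +-identityʳ k | +-identityʳ k = cong₂ _*_ (nCn≡1 k) (nCn≡1 k)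

binom-ℕ : ∀ K i → binom (+ K) i ≡ ιₙ (K C i)
binom-ℕ K zero    = refl
binom-ℕ K (suc i) = *-ιₙ-suc-cancelʳ i (begin
  binom (+ K) i Q.* ((+ K ℤ.- + i) / suc i) Q.* ιₙ (suc i)
    ≡⟨ cong₂ (λ x y → x Q.* y Q.* ιₙ (suc i)) (binom-ℕ K i) (/suc≡*1/suc (+ K ℤ.- + i) i) ⟩
  ιₙ (K C i) Q.* (ι (+ K ℤ.- + i) Q.* 1/suc i) Q.* ιₙ (suc i)
    ≡⟨ solve 4 (λ A B C D → (A :* (B :* C)) :* D := (A :* B) :* (D :* C)) refl
         (ιₙ (K C i)) (ι (+ K ℤ.- + i)) (1/suc i) (ιₙ (suc i)) ⟩
  ιₙ (K C i) Q.* ι (+ K ℤ.- + i) Q.* (ιₙ (suc i) Q.* 1/suc i)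
    ≡⟨ cong (ιₙ (K C i) Q.* ι (+ K ℤ.- + i) Q.*_) (ιₙ-suc-*-1/suc i) ⟩
  ιₙ (K C i) Q.* ι (+ K ℤ.- + i) Q.* 1ℚ
    ≡⟨ QP.*-identityʳ _ ⟩
  ιₙ (K C i) Q.* ι (+ K ℤ.- + i)
    ≡⟨ C-*-difference ⟩
  ιₙ (K C i) Q.* ιₙ (K ∸ i)
    ≡⟨ ιₙ-* (K C i) (K ∸ i) ⟨
  ιₙ ((K C i) * (K ∸ i))
    ≡⟨ cong ιₙ (C-absorption K i) ⟨
  ιₙ ((K C suc i) * suc i)
    ≡⟨ ιₙ-* (K C suc i) (suc i) ⟩
  ιₙ (K C suc i) Q.* ιₙ (suc i)
    ∎)
  where
  -- K - i may be negative, but then K C i vanishes.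
  C-*-difference : ιₙ (K C i) Q.* ι (+ K ℤ.- + i) ≡ ιₙ (K C i) Q.* ιₙ (K ∸ i)
  C-*-difference with ≤-<-connex i K
  ... | inj₁ i≤K = cong (λ z → ιₙ (K C i) Q.* ι z) (trans (ℤP.m-n≡m⊖n K i) (ℤP.⊖-≥ i≤K))
  ... | inj₂ K<i rewrite k>n⇒nCk≡0 K<i = trans (QP.*-zeroˡ (ι (+ K ℤ.- + i))) (sym (QP.*-zeroˡ (ιₙ (K ∸ i))))

trinomial-predˡ : ℕ → ℕ → ℕ → ℕ
trinomial-predˡ zero    j l = 0
trinomial-predˡ (suc i) j l = trinomial i j l

trinomial-predᵐ : ℕ → ℕ → ℕ → ℕ
trinomial-predᵐ i zero    l = 0
trinomial-predᵐ i (suc j) l = trinomial i j l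

trinomial-predˡ-ratio : ∀ i j l → (i + j + l) * trinomial-predˡ i j l ≡ i * trinomial i j l
trinomial-predˡ-ratio zero    j l = *-zeroʳ (j + l)
trinomial-predˡ-ratio (suc i) j l = trinomial-sucˡ i j l

trinomial-predᵐ-ratio : ∀ i j l → (i + j + l) * trinomial-predᵐ i j l ≡ j * trinomial i j l
trinomial-predᵐ-ratio i zero    l = *-zeroʳ (i + 0 + l)
trinomial-predᵐ-ratio i (suc j) l = trinomial-sucᵐ i j l

private
  cleared-identity : ∀ X d i j M Mₗ Mₗ′ Mₘ {L} .{{_ : NonZero L}} → L ≡ X + j + d * i →
    (i + j + L) * Mₗ ≡ i * M → (i + j + L) * Mₗ′ ≡ L * M → (i + j + L) * Mₘ ≡ j * M →
    suc X * M * L ≡ suc (X + d) * Mₗ * L + X * Mₗ′ * suc L + suc (suc X) * Mₘ * L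
  cleared-identity X d i j M Mₗ Mₗ′ Mₘ {L} refl tMₗ≡iM tMₗ′≡LM tMₘ≡jM = *-cancelˡ-≡ _ _ t {{t≢0}} (begin
    t * (suc X * M * L)                                                          ≡⟨ expand X d i j M ⟩
    suc (X + d) * L * (i * M) + X * suc L * (L * M) + suc (suc X) * L * (j * M)  ≡⟨ cong₂ _+_ (cong₂ _+_
                                                                                      (cong (suc (X + d) * L *_) tMₗ≡iM)
                                                                                      (cong (X * suc L *_) tMₗ′≡LM))
                                                                                      (cong (suc (suc X) * L *_) tMₘ≡jM) ⟨
    suc (X + d) * L * (t * Mₗ) + X * suc L * (t * Mₗ′) + suc (suc X) * L * (t * Mₘ)  ≡⟨ factor X d i j Mₗ Mₗ′ Mₘ ⟩
    t * (suc (X + d) * Mₗ * L + X * Mₗ′ * suc L + suc (suc X) * Mₘ * L)              ∎)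
    where
    t = i + j + L
    t≢0 : NonZero t
    t≢0 = >-nonZero (<-≤-trans (>-nonZero⁻¹ L) (m≤n+m L (i + j)))
    expand : ∀ X d i j M → let L = X + j + d * i in
      (i + j + L) * (suc X * M * L) ≡ suc (X + d) * L * (i * M) + X * suc L * (L * M) + suc (suc X) * L * (j * M)
    expand = ℕ-Solver.solve-∀
    factor : ∀ X d i j Mₗ Mₗ′ Mₘ → let L = X + j + d * i; t = i + j + L in
      suc (X + d) * L * (t * Mₗ) + X * suc L * (t * Mₗ′) + suc (suc X) * L * (t * Mₘ)
        ≡ t * (suc (X + d) * Mₗ * L + X * Mₗ′ * suc L + suc (suc X) * Mₘ * L)
    factor = ℕ-Solver.solve-∀

-- Dividing by M(i,j,l+1), this is a polynomial identity in X, d, i, j once l + 1 = X + j + d i.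
trinomial-recurrence : ∀ X d i j l → suc l ≡ X + j + d * i →
  suc X * trinomial i j (suc l) * suc l
    ≡ suc (X + d) * trinomial-predˡ i j (suc l) * suc l + X * trinomial i j l * suc (suc l)
      + suc (suc X) * trinomial-predᵐ i j (suc l) * suc l
trinomial-recurrence X d i j l 1+l≡X+j+di =
  cleared-identity X d i j (trinomial i j (suc l)) (trinomial-predˡ i j (suc l)) (trinomial i j l)
    (trinomial-predᵐ i j (suc l)) 1+l≡X+j+di
    (trinomial-predˡ-ratio i j (suc l)) (trinomial-sucʳ i j l) (trinomial-predᵐ-ratio i j (suc l))

-- The recurrence characterising s_n(m)

left : (ℕ → ℕ → ℚ) → ℕ → ℕ → ℚ
left f zero    m = 0ℚ
left f (suc n) m = f n m

beforePattern : ℕ → ℕ → (ℕ → ℕ → ℚ) → ℕ → ℕ → ℚ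
beforePattern a c f n m with a ≤? n
... | yes _ = f (n ∸ a) (m ∸ c)
... | no  _ = 0ℚ

module _ {a c : ℕ} {f : ℕ → ℕ → ℚ} {n m : ℕ} where
  beforePattern-room : a ≤ n → beforePattern a c f n m ≡ f (n ∸ a) (m ∸ c)
  beforePattern-room a≤n with a ≤? n
  ... | yes _   = refl
  ... | no  a≰n = contradiction a≤n a≰n

  beforePattern-no-room : ¬ a ≤ n → beforePattern a c f n m ≡ 0ℚ
  beforePattern-no-room a≰n with a ≤? n
  ... | yes a≤n = contradiction a≤n a≰n
  ... | no  _   = refl

record Recurrence (a c : ℕ) (f : ℕ → ℕ → ℚ) : Set where
  field
    at-origin      : f 0 0 ≡ 1ℚ
    below-diagonal : ∀ m → f (suc m) m ≡ 0ℚ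
    step           : ∀ n m → n ≤ suc m →
                     f n (suc m) Q.+ beforePattern a c f n (suc m) ≡ f n m Q.+ left f n (suc m)

module _ {a c f g} (1≤a : 1 ≤ a) (c≤a : c ≤ a) (F : Recurrence a c f) (G : Recurrence a c g) where
  private
    module F = Recurrence F
    module G = Recurrence G

    agree : ∀ k n m → n + m ≤ k → n ≤ m → f n m ≡ g n m
    agree k       zero zero    _         _     = trans F.at-origin (sym G.at-origin)
    agree (suc k) n    (suc m) n+1+m≤1+k n≤1+m = ℚ-+-cancelʳ (beforePattern a c f n (suc m)) (begin
      f n (suc m) Q.+ beforePattern a c f n (suc m)  ≡⟨ F.step n m n≤1+m ⟩
      f n m Q.+ left f n (suc m)                     ≡⟨ cong₂ Q._+_ agree-below (agree-left n+1+m≤1+k n≤1+m) ⟩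
      g n m Q.+ left g n (suc m)                     ≡⟨ G.step n m n≤1+m ⟨
      g n (suc m) Q.+ beforePattern a c g n (suc m)  ≡⟨ cong (g n (suc m) Q.+_) agree-beforePattern ⟨
      g n (suc m) Q.+ beforePattern a c f n (suc m)  ∎)
      where
      n+m≤k : n + m ≤ k
      n+m≤k = ≤-pred (subst (_≤ suc k) (+-suc n m) n+1+m≤1+k)

      agree-below : f n m ≡ g n m
      agree-below with m≤n⇒m<n∨m≡n n≤1+m
      ... | inj₁ (s≤s n≤m) = agree k n m n+m≤k n≤m
      ... | inj₂ refl      = trans (F.below-diagonal m) (sym (G.below-diagonal m))

      agree-left : ∀ {n} → n + suc m ≤ suc k → n ≤ suc m → left f n (suc m) ≡ left g n (suc m)
      agree-left {zero}   _                  _      = refl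
      agree-left {suc n′} (s≤s n′+1+m≤k) n′<1+m = agree k n′ (suc m) n′+1+m≤k (<⇒≤ n′<1+m)

      agree-beforePattern : beforePattern a c f n (suc m) ≡ beforePattern a c g n (suc m)
      agree-beforePattern with a ≤? n
      ... | no  _   = refl
      ... | yes a≤n = agree k (n ∸ a) (suc m ∸ c) sum≤k
                        (≤-trans (∸-monoˡ-≤ a n≤1+m) (∸-monoʳ-≤ (suc m) c≤a))
        where
        sum≤k : (n ∸ a) + (suc m ∸ c) ≤ k
        sum≤k = ≤-trans (+-monoʳ-≤ (n ∸ a) (m∸n≤m (suc m) c))
                  (≤-trans (≤-reflexive (+-suc (n ∸ a) m))
                    (≤-trans (+-monoˡ-≤ m (∸-monoʳ-< {n} {a} {0} 1≤a a≤n)) n+m≤k))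

  Recurrence-unique : ∀ {n m} → n ≤ m → f n m ≡ g n m
  Recurrence-unique {n} {m} = agree (n + m) n m ≤-refl

module _ (a c n : ℕ) (y z : ℤ) (i : ℕ) where
  private
    B₁ B₂ : ℚ
    B₁ = binom (+ (n ∸ (a ∸ 1) * i)) i
    B₂ = binom (z ℤ.- + ((a + c ∸ 1) * i)) (n ∸ (a ∸ 1) * i)

  summand-vanishes : B₁ ≡ 0ℚ → summand a c n y z i ≡ 0ℚ
  summand-vanishes B₁≡0 with B₁ Q.≟ 0ℚ | B₂ Q.≟ 0ℚ
  ... | yes _    | _ = refl
  ... | no B₁≢0 | _ = contradiction B₁≡0 B₁≢0

  summand-at-pole : y ℤ.- + (c * i) ℤ.+ + 1 ≡ + 0 → summand a c n y z i ≡ 0ℚ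
  summand-at-pole pole with B₁ Q.≟ 0ℚ | B₂ Q.≟ 0ℚ
  ... | yes _ | _     = refl
  ... | no _  | yes _ = refl
  ... | no _  | no _  rewrite pole = refl

  summand-regular : B₁ ≢ 0ℚ → B₂ ≢ 0ℚ →
                    summand a c n y z i ≡ divℤ (sign i Q.* B₁ Q.* B₂) (y ℤ.- + (c * i) ℤ.+ + 1)
  summand-regular B₁≢0 B₂≢0 with B₁ Q.≟ 0ℚ | B₂ Q.≟ 0ℚ
  ... | yes B₁≡0 | _        = contradiction B₁≡0 B₁≢0
  ... | no _     | yes B₂≡0 = contradiction B₂≡0 B₂≢0
  ... | no _     | no _     = refl

+m-+n+1≡+P : ∀ {m n P} → m + 1 ≡ P + n → + m ℤ.- + n ℤ.+ + 1 ≡ + P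
+m-+n+1≡+P {m} {n} {P} m+1≡P+n = begin
  + m ℤ.- + n ℤ.+ + 1      ≡⟨ shuffle (+ m) (+ n) ⟩
  + (m + 1) ℤ.- + n        ≡⟨ ℤP.m-n≡m⊖n (m + 1) n ⟩
  (m + 1) ℤ.⊖ n            ≡⟨ ℤP.⊖-≥ (subst (n ≤_) (sym m+1≡P+n) (m≤n+m n P)) ⟩
  + ((m + 1) ∸ n)          ≡⟨ cong (λ k → + (k ∸ n)) m+1≡P+n ⟩
  + ((P + n) ∸ n)          ≡⟨ cong +_ (m+n∸n≡m P n) ⟩
  + P                      ∎
  where
  shuffle : ∀ x y → x ℤ.- y ℤ.+ + 1 ≡ x ℤ.+ + 1 ℤ.- y
  shuffle = ℤ-Solver.solve-∀

-- trinomial-recurrence divided by (l + 1)(l + 2), with the sign s of the terms.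
fraction-step : ∀ (s : ℚ) x₁ m₁ x₂ m₂ x₃ m₃ x₄ m₄ l →
  x₁ * m₁ * suc l ≡ x₂ * m₂ * suc l + x₃ * m₃ * suc (suc l) + x₄ * m₄ * suc l →
  ιₙ x₁ Q.* (s Q.* ιₙ m₁ Q.* 1/suc (suc l)) Q.+ ιₙ x₂ Q.* ((Q.- s) Q.* ιₙ m₂ Q.* 1/suc (suc l))
    ≡ ιₙ x₃ Q.* (s Q.* ιₙ m₃ Q.* 1/suc l) Q.+ ιₙ x₄ Q.* (s Q.* ιₙ m₄ Q.* 1/suc (suc l))
fraction-step s x₁ m₁ x₂ m₂ x₃ m₃ x₄ m₄ l eq = begin
  ιₙ x₁ Q.* (s Q.* ιₙ m₁ Q.* J′) Q.+ ιₙ x₂ Q.* ((Q.- s) Q.* ιₙ m₂ Q.* J′)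
    ≡⟨ solve 8 (λ X₁ M₁ X₂ M₂ X₄ M₄ S J′ → X₁ :* (S :* M₁ :* J′) :+ X₂ :* ((:- S) :* M₂ :* J′)
                 := S :* ((X₁ :* M₁ :- X₂ :* M₂ :- X₄ :* M₄) :* J′) :+ X₄ :* (S :* M₄ :* J′))
         refl (ιₙ x₁) (ιₙ m₁) (ιₙ x₂) (ιₙ m₂) (ιₙ x₄) (ιₙ m₄) s J′ ⟩
  s Q.* (D Q.* J′) Q.+ ιₙ x₄ Q.* (s Q.* ιₙ m₄ Q.* J′)
    ≡⟨ cong (λ y → s Q.* y Q.+ ιₙ x₄ Q.* (s Q.* ιₙ m₄ Q.* J′)) (*-1/suc-cross {D} {P₃} l DL≡P₃L′) ⟩
  s Q.* (P₃ Q.* J) Q.+ ιₙ x₄ Q.* (s Q.* ιₙ m₄ Q.* J′)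
    ≡⟨ cong (Q._+ ιₙ x₄ Q.* (s Q.* ιₙ m₄ Q.* J′))
         (solve 4 (λ S X₃ M₃ J → S :* (X₃ :* M₃ :* J) := X₃ :* (S :* M₃ :* J)) refl s (ιₙ x₃) (ιₙ m₃) J) ⟩
  ιₙ x₃ Q.* (s Q.* ιₙ m₃ Q.* J) Q.+ ιₙ x₄ Q.* (s Q.* ιₙ m₄ Q.* J′)
    ∎
  where
  J = 1/suc l
  J′ = 1/suc (suc l)
  L = ιₙ (suc l)
  L′ = ιₙ (suc (suc l))
  P₁ = ιₙ x₁ Q.* ιₙ m₁
  P₂ = ιₙ x₂ Q.* ιₙ m₂
  P₃ = ιₙ x₃ Q.* ιₙ m₃
  P₄ = ιₙ x₄ Q.* ιₙ m₄
  D = P₁ Q.- P₂ Q.- P₄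
  ιₙ-*-* : ∀ x m k → ιₙ (x * m * k) ≡ ιₙ x Q.* ιₙ m Q.* ιₙ k
  ιₙ-*-* x m k = trans (ιₙ-* (x * m) k) (cong (Q._* ιₙ k) (ιₙ-* x m))
  P₁L≡ : P₁ Q.* L ≡ P₂ Q.* L Q.+ P₃ Q.* L′ Q.+ P₄ Q.* L
  P₁L≡ = begin
    P₁ Q.* L
      ≡⟨ ιₙ-*-* x₁ m₁ (suc l) ⟨
    ιₙ (x₁ * m₁ * suc l)
      ≡⟨ cong ιₙ eq ⟩
    ιₙ (x₂ * m₂ * suc l + x₃ * m₃ * suc (suc l) + x₄ * m₄ * suc l)
      ≡⟨ ιₙ-+ (x₂ * m₂ * suc l + x₃ * m₃ * suc (suc l)) (x₄ * m₄ * suc l) ⟩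
    ιₙ (x₂ * m₂ * suc l + x₃ * m₃ * suc (suc l)) Q.+ ιₙ (x₄ * m₄ * suc l)
      ≡⟨ cong (Q._+ ιₙ (x₄ * m₄ * suc l)) (ιₙ-+ (x₂ * m₂ * suc l) (x₃ * m₃ * suc (suc l))) ⟩
    ιₙ (x₂ * m₂ * suc l) Q.+ ιₙ (x₃ * m₃ * suc (suc l)) Q.+ ιₙ (x₄ * m₄ * suc l)
      ≡⟨ cong₂ Q._+_ (cong₂ Q._+_ (ιₙ-*-* x₂ m₂ (suc l)) (ιₙ-*-* x₃ m₃ (suc (suc l)))) (ιₙ-*-* x₄ m₄ (suc l)) ⟩
    P₂ Q.* L Q.+ P₃ Q.* L′ Q.+ P₄ Q.* L
      ∎
  DL≡P₃L′ : D Q.* L ≡ P₃ Q.* L′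
  DL≡P₃L′ = begin
    (P₁ Q.- P₂ Q.- P₄) Q.* L                        ≡⟨ solve 4 (λ A B C L → (A :- B :- C) :* L := A :* L :- B :* L :- C :* L) refl P₁ P₂ P₄ L ⟩
    P₁ Q.* L Q.- P₂ Q.* L Q.- P₄ Q.* L              ≡⟨ cong (λ y → y Q.- P₂ Q.* L Q.- P₄ Q.* L) P₁L≡ ⟩
    P₂ Q.* L Q.+ P₃ Q.* L′ Q.+ P₄ Q.* L Q.- P₂ Q.* L Q.- P₄ Q.* L
      ≡⟨ solve 5 (λ B C E L L′ → B :* L :+ C :* L′ :+ E :* L :- B :* L :- E :* L := C :* L′) refl P₂ P₃ P₄ L L′ ⟩
    P₃ Q.* L′                                       ∎

+-*-suc-∸ : ∀ x k i → x + k * suc i ∸ k ≡ x + k * i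
+-*-suc-∸ x k i = trans (cong (_∸ k) (regroup x k i)) (m+n∸n≡m (x + k * i) k)
  where
  regroup : ∀ x k i → x + k * suc i ≡ x + k * i + k
  regroup = ℕ-Solver.solve-∀

-- With a = suc a₁, the a ∸ 1 and a + c ∸ 1 inside the summands compute.
module Terms (a₁ c : ℕ) where
  a : ℕ
  a = suc a₁

  term : ℕ → ℕ → ℕ → ℚ
  term n m i = ι (+ m ℤ.- + n ℤ.+ + 1) Q.* summand a c n (+ m) (+ m ℤ.+ + n) i

  term-vanishes : ∀ {n m i} → n < a * i → term n m i ≡ 0ℚ
  term-vanishes {n} {m} {zero}  n<a0 = contradiction (subst (n <_) (*-zeroʳ a) n<a0) n≮0
  term-vanishes {n} {m} {suc i} n<ai =
    trans (cong (ι (+ m ℤ.- + n ℤ.+ + 1) Q.*_) (summand-vanishes a c n _ _ (suc i) B₁≡0)) (QP.*-zeroʳ (ι (+ m ℤ.- + n ℤ.+ + 1)))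
    where
    n∸a₁i<i : n ∸ a₁ * suc i < suc i
    n∸a₁i<i = m<n+o⇒m∸n<o n (a₁ * suc i) (subst (n <_) (+-comm (suc i) (a₁ * suc i)) n<ai)
    B₁≡0 : binom (+ (n ∸ a₁ * suc i)) (suc i) ≡ 0ℚ
    B₁≡0 = trans (binom-ℕ _ (suc i)) (cong ιₙ (k>n⇒nCk≡0 n∸a₁i<i))

  term-at-pole : ∀ {n m i} → suc m ≡ c * i → term n m i ≡ 0ℚ
  term-at-pole {n} {m} {i} 1+m≡ci =
    trans (cong (ι (+ m ℤ.- + n ℤ.+ + 1) Q.*_) (summand-at-pole a c n _ _ i (+m-+n+1≡+P {m} {c * i} {0} (trans (+-comm m 1) 1+m≡ci))))
          (QP.*-zeroʳ (ι (+ m ℤ.- + n ℤ.+ + 1)))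

  -- With n = j + a i and m = l + c i the binomials in the i-th summand become (i+j choose i) and
  -- (i+j+l choose i+j), and the denominator becomes l + 1.
  term-closed-form : ∀ {n m} i j l P → n ≡ j + a * i → m ≡ l + c * i → l + c * i + 1 ≡ P + (j + a * i) →
                     term n m i ≡ ιₙ P Q.* (sign i Q.* ιₙ (trinomial i j l) Q.* 1/suc l)
  term-closed-form i j l P refl refl m+1≡P+n = begin
    ι (+ m ℤ.- + n ℤ.+ + 1) Q.* summand a c n (+ m) (+ m ℤ.+ + n) i
      ≡⟨ cong₂ Q._*_ (cong ι (+m-+n+1≡+P {m} {n} {P} m+1≡P+n)) (summand-regular a c n _ _ i B₁≢0 B₂≢0) ⟩
    ιₙ P Q.* divℤ (sign i Q.* B₁ Q.* B₂) (+ m ℤ.- + (c * i) ℤ.+ + 1)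
      ≡⟨ cong (λ d → ιₙ P Q.* divℤ (sign i Q.* B₁ Q.* B₂) d) (+m-+n+1≡+P {m} {c * i} {suc l} (+-comm m 1)) ⟩
    ιₙ P Q.* (sign i Q.* B₁ Q.* B₂ Q.* 1/suc l)
      ≡⟨ cong (λ x → ιₙ P Q.* (x Q.* 1/suc l)) B₁B₂≡trinomial ⟩
    ιₙ P Q.* (sign i Q.* ιₙ (trinomial i j l) Q.* 1/suc l)
      ∎
    where
    n = j + a * i
    m = l + c * i
    n∸a₁i≡i+j : n ∸ a₁ * i ≡ i + j
    n∸a₁i≡i+j = trans (cong (_∸ a₁ * i) (regroup i j a₁)) (m+n∸n≡m (i + j) (a₁ * i))
      where
      regroup : ∀ i j a₁ → j + (i + a₁ * i) ≡ i + j + a₁ * i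
      regroup = ℕ-Solver.solve-∀
    m+n-[a₁+c]i≡i+j+l : + m ℤ.+ + n ℤ.- + ((a₁ + c) * i) ≡ + (i + j + l)
    m+n-[a₁+c]i≡i+j+l = begin
      + (m + n) ℤ.- + ((a₁ + c) * i)               ≡⟨ cong (λ k → + k ℤ.- + ((a₁ + c) * i)) (regroup i j l a₁ c) ⟩
      + (i + j + l + (a₁ + c) * i) ℤ.- + ((a₁ + c) * i) ≡⟨ ℤP.m-n≡m⊖n _ ((a₁ + c) * i) ⟩
      (i + j + l + (a₁ + c) * i) ℤ.⊖ ((a₁ + c) * i) ≡⟨ ℤP.⊖-≥ (m≤n+m ((a₁ + c) * i) (i + j + l)) ⟩
      + (i + j + l + (a₁ + c) * i ∸ (a₁ + c) * i)  ≡⟨ cong +_ (m+n∸n≡m (i + j + l) ((a₁ + c) * i)) ⟩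
      + (i + j + l)                                ∎
      where
      regroup : ∀ i j l a₁ c → l + c * i + (j + (i + a₁ * i)) ≡ i + j + l + (a₁ + c) * i
      regroup = ℕ-Solver.solve-∀
    B₁ = binom (+ (n ∸ a₁ * i)) i
    B₂ = binom (+ m ℤ.+ + n ℤ.- + ((a₁ + c) * i)) (n ∸ a₁ * i)
    B₁≡ : B₁ ≡ ιₙ ((i + j) C i)
    B₁≡ = trans (cong (λ k → binom (+ k) i) n∸a₁i≡i+j) (binom-ℕ (i + j) i)
    B₂≡ : B₂ ≡ ιₙ ((i + j + l) C (i + j))
    B₂≡ = trans (cong₂ binom m+n-[a₁+c]i≡i+j+l n∸a₁i≡i+j) (binom-ℕ (i + j + l) (i + j))
    B₁≢0 : B₁ ≢ 0ℚ
    B₁≢0 B₁≡0 = C-+≢0 i j (ιₙ-injective (trans (sym B₁≡) B₁≡0))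
    B₂≢0 : B₂ ≢ 0ℚ
    B₂≢0 B₂≡0 = C-+≢0 (i + j) l (ιₙ-injective (trans (sym B₂≡) B₂≡0))
    B₁B₂≡trinomial : sign i Q.* B₁ Q.* B₂ ≡ sign i Q.* ιₙ (trinomial i j l)
    B₁B₂≡trinomial = begin
      sign i Q.* B₁ Q.* B₂                                          ≡⟨ cong₂ (λ x y → sign i Q.* x Q.* y) B₁≡ B₂≡ ⟩
      sign i Q.* ιₙ ((i + j) C i) Q.* ιₙ ((i + j + l) C (i + j))    ≡⟨ QP.*-assoc (sign i) _ _ ⟩
      sign i Q.* (ιₙ ((i + j) C i) Q.* ιₙ ((i + j + l) C (i + j)))  ≡⟨ cong (sign i Q.*_) (ιₙ-* ((i + j) C i) _) ⟨
      sign i Q.* ιₙ (trinomial i j l)                               ∎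

  patternTerm : ℕ → ℕ → ℕ → ℚ
  patternTerm n m zero    = 0ℚ
  patternTerm n m (suc i) = beforePattern a c (λ n′ m′ → term n′ m′ i) n m

  leftTerm : ℕ → ℕ → ℕ → ℚ
  leftTerm n m i = left (λ n′ m′ → term n′ m′ i) n m

  patternTerm-suc : ∀ {n m i} → a ≤ n → patternTerm n m (suc i) ≡ term (n ∸ a) (m ∸ c) i
  patternTerm-suc {n} a≤n with a ≤? n
  ... | yes _   = refl
  ... | no  a≰n = contradiction a≤n a≰n

  patternTerm-vanishes : ∀ {n m i} → n < a * i → patternTerm n m i ≡ 0ℚ
  patternTerm-vanishes {i = zero}        _    = refl
  patternTerm-vanishes {n} {m} {suc i} n<ai with a ≤? n
  ... | no  _   = refl
  ... | yes a≤n = term-vanishes (subst (n ∸ a <_) (m+n∸m≡n a (a * i)) (∸-monoˡ-< (subst (n <_) (*-suc a i) n<ai) a≤n))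

  leftTerm-vanishes : ∀ {n m i} → n ≤ a * i → leftTerm n m i ≡ 0ℚ
  leftTerm-vanishes {zero}  _     = refl
  leftTerm-vanishes {suc n} n<ai = term-vanishes n<ai

  TermStep : ℕ → ℕ → ℕ → Set
  TermStep n m i = term n (suc m) i Q.+ patternTerm n (suc m) i ≡ term n m i Q.+ leftTerm n (suc m) i

  module _ (c≤a : c ≤ a) where
    private
      d : ℕ
      d = a ∸ c

      a≡c+d : a ≡ c + d
      a≡c+d = sym (m+[n∸m]≡n c≤a)

      excess : ∀ {X i j L} → L ≡ X + j + d * i → L + c * i ≡ X + (j + a * i)
      excess {X} {i} {j} refl = trans (regroup X j d i c) (cong (λ a′ → X + (j + a′ * i)) (sym a≡c+d))
        where
        regroup : ∀ X j d i c → X + j + d * i + c * i ≡ X + (j + (c + d) * i)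
        regroup = ℕ-Solver.solve-∀

      term-step : ∀ X i j l → suc l ≡ X + j + d * i → TermStep (j + a * i) (l + c * i) i
      term-step X i j l 1+l≡X+j+di = begin
        term n (suc l + c * i) i Q.+ patternTerm n (suc l + c * i) i
          ≡⟨ cong₂ Q._+_ (term-closed-form i j (suc l) (suc X) refl refl
                           (trans (+-comm (suc l + c * i) 1) (cong suc (excess {X} {i} {j} 1+l≡X+j+di))))
                         (patternTerm-closed-form i 1+l≡X+j+di) ⟩
        ιₙ (suc X) Q.* (σ Q.* ιₙ M Q.* J′) Q.+ ιₙ (suc (X + d)) Q.* ((Q.- σ) Q.* ιₙ Mₗ Q.* J′)
          ≡⟨ fraction-step σ (suc X) M (suc (X + d)) Mₗ X Mₗ′ (suc (suc X)) Mₘ l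
               (trinomial-recurrence X d i j l 1+l≡X+j+di) ⟩
        ιₙ X Q.* (σ Q.* ιₙ Mₗ′ Q.* J) Q.+ ιₙ (suc (suc X)) Q.* (σ Q.* ιₙ Mₘ Q.* J′)
          ≡⟨ cong₂ Q._+_ (term-closed-form i j l X refl refl (trans (+-comm (l + c * i) 1) (excess {X} {i} {j} 1+l≡X+j+di)))
                         (leftTerm-closed-form j 1+l≡X+j+di) ⟨
        term n (l + c * i) i Q.+ leftTerm n (suc l + c * i) i
          ∎
        where
        n = j + a * i
        σ = sign i
        J = 1/suc l
        J′ = 1/suc (suc l)
        M = trinomial i j (suc l)
        Mₗ = trinomial-predˡ i j (suc l)
        Mₗ′ = trinomial i j l
        Mₘ = trinomial-predᵐ i j (suc l)

        patternTerm-closed-form : ∀ i → suc l ≡ X + j + d * i →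
          patternTerm (j + a * i) (suc l + c * i) i ≡ ιₙ (suc (X + d)) Q.* ((Q.- sign i) Q.* ιₙ (trinomial-predˡ i j (suc l)) Q.* J′)
        patternTerm-closed-form zero     _ = solve 2 (λ x J′ → con 0ℚ := x :* ((:- con 1ℚ) :* con 0ℚ :* J′)) refl (ιₙ (suc (X + d))) J′
        patternTerm-closed-form (suc i′) 1+l≡X+j+d[1+i′] = begin
          patternTerm (j + a * suc i′) (suc l + c * suc i′) (suc i′)
            ≡⟨ patternTerm-suc {j + a * suc i′} {suc l + c * suc i′} {i′} (≤-trans (m≤m*n a (suc i′)) (m≤n+m (a * suc i′) j)) ⟩
          term (j + a * suc i′ ∸ a) (suc l + c * suc i′ ∸ c) i′
            ≡⟨ term-closed-form i′ j (suc l) (suc (X + d)) (+-*-suc-∸ j a i′) (+-*-suc-∸ (suc l) c i′)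
                 (trans (+-comm (suc l + c * i′) 1) (cong suc (excess {X + d} {i′} {j} (trans 1+l≡X+j+d[1+i′] (regroup X j d i′))))) ⟩
          ιₙ (suc (X + d)) Q.* (sign i′ Q.* ιₙ (trinomial i′ j (suc l)) Q.* J′)
            ≡⟨ cong (λ σ → ιₙ (suc (X + d)) Q.* (σ Q.* ιₙ (trinomial i′ j (suc l)) Q.* J′))
                    (solve 1 (λ σ → σ := :- (:- σ)) refl (sign i′)) ⟩
          ιₙ (suc (X + d)) Q.* ((Q.- sign (suc i′)) Q.* ιₙ (trinomial i′ j (suc l)) Q.* J′)
            ∎
          where
          regroup : ∀ X j d i → X + j + d * suc i ≡ X + d + j + d * i
          regroup = ℕ-Solver.solve-∀

        leftTerm-closed-form : ∀ j → suc l ≡ X + j + d * i →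
          leftTerm (j + a * i) (suc l + c * i) i ≡ ιₙ (suc (suc X)) Q.* (σ Q.* ιₙ (trinomial-predᵐ i j (suc l)) Q.* J′)
        leftTerm-closed-form zero     _ = trans (leftTerm-vanishes {0 + a * i} {suc l + c * i} {i} ≤-refl)
          (solve 3 (λ x σ J′ → con 0ℚ := x :* (σ :* con 0ℚ :* J′)) refl (ιₙ (suc (suc X))) σ J′)
        leftTerm-closed-form (suc j′) 1+l≡X+1+j′+di = term-closed-form i j′ (suc l) (suc (suc X)) refl refl
          (trans (+-comm (suc l + c * i) 1) (cong suc (trans (excess {X} {i} {suc j′} 1+l≡X+1+j′+di) (+-suc X (j′ + a * i)))))

      -- The point (n, m+1) = (a i, c i): here j = X = 0 and d = 0.
      term-step-degenerate : ∀ {m} X i j → 0 ≡ X + j + d * i → suc m ≡ c * i → TermStep (j + a * i) m i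
      term-step-degenerate {m} X (suc i) j 0≡X+j+di 1+m≡ci = begin
        term n (suc m) (suc i) Q.+ patternTerm n (suc m) (suc i)
          ≡⟨ cong₂ Q._+_ (term-closed-form (suc i) 0 0 1 n≡ 1+m≡ci (ci+1≡1+ai (suc i)))
                         (trans (patternTerm-suc {n} {suc m} {i} (≤-trans (m≤m*n a (suc i)) (m≤n+m (a * suc i) j)))
                                (term-closed-form i 0 0 1 (trans (cong (_∸ a) n≡) (+-*-suc-∸ 0 a i))
                                   (trans (cong (_∸ c) 1+m≡ci) (+-*-suc-∸ 0 c i)) (ci+1≡1+ai i))) ⟩
        ιₙ 1 Q.* (sign (suc i) Q.* ιₙ (trinomial (suc i) 0 0) Q.* 1/suc 0)
          Q.+ ιₙ 1 Q.* (sign i Q.* ιₙ (trinomial i 0 0) Q.* 1/suc 0)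
          ≡⟨ cong₂ (λ x y → ιₙ 1 Q.* (sign (suc i) Q.* ιₙ x Q.* 1/suc 0) Q.+ ιₙ 1 Q.* (sign i Q.* ιₙ y Q.* 1/suc 0))
                   (trinomial-zero (suc i)) (trinomial-zero i) ⟩
        ιₙ 1 Q.* ((Q.- sign i) Q.* ιₙ 1 Q.* 1/suc 0) Q.+ ιₙ 1 Q.* (sign i Q.* ιₙ 1 Q.* 1/suc 0)
          ≡⟨ solve 3 (λ o σ J → o :* ((:- σ) :* o :* J) :+ o :* (σ :* o :* J) := con 0ℚ :+ con 0ℚ) refl (ιₙ 1) (sign i) (1/suc 0) ⟩
        0ℚ Q.+ 0ℚ
          ≡⟨ cong₂ Q._+_ (term-at-pole {n} {m} {suc i} 1+m≡ci) (leftTerm-vanishes {n} {suc m} {suc i} (≤-reflexive n≡)) ⟨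
        term n m (suc i) Q.+ leftTerm n (suc m) (suc i)
          ∎
        where
        n = j + a * suc i
        j≡0 : j ≡ 0
        j≡0 = m+n≡0⇒n≡0 X (m+n≡0⇒m≡0 (X + j) (sym 0≡X+j+di))
        d≡0 : d ≡ 0
        d≡0 with m*n≡0⇒m≡0∨n≡0 d (m+n≡0⇒n≡0 (X + j) (sym 0≡X+j+di))
        ... | inj₁ d≡0 = d≡0
        n≡ : n ≡ 0 + a * suc i
        n≡ = cong (_+ a * suc i) j≡0
        c≡a : c ≡ a
        c≡a = sym (trans a≡c+d (trans (cong (λ x → c + x) d≡0) (+-identityʳ c)))
        ci+1≡1+ai : ∀ k → 0 + c * k + 1 ≡ 1 + (0 + a * k)
        ci+1≡1+ai k = trans (+-comm (c * k) 1) (cong (λ x → 1 + x * k) c≡a)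
      term-step-degenerate X zero j _ 1+m≡c0 = contradiction (trans 1+m≡c0 (*-zeroʳ c)) λ ()

      term-step-any : ∀ {m} X i j l → suc m ≡ l + c * i → l ≡ X + j + d * i → TermStep (j + a * i) m i
      term-step-any X i j zero    1+m≡ci l≡X+j+di = term-step-degenerate X i j l≡X+j+di 1+m≡ci
      term-step-any X i j (suc l) refl   l≡X+j+di = term-step X i j l l≡X+j+di

    term-recurrence : ∀ n m i → n ≤ suc m → TermStep n m i
    term-recurrence n m i n≤1+m with ≤-<-connex (a * i) n
    ... | inj₂ n<ai = begin
      term n (suc m) i Q.+ patternTerm n (suc m) i   ≡⟨ cong₂ Q._+_ (term-vanishes n<ai) (patternTerm-vanishes n<ai) ⟩
      0ℚ Q.+ 0ℚ                                      ≡⟨ cong₂ Q._+_ (term-vanishes n<ai) (leftTerm-vanishes (<⇒≤ n<ai)) ⟨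
      term n m i Q.+ leftTerm n (suc m) i            ∎
    ... | inj₁ ai≤n = subst (λ n′ → TermStep n′ m i) (sym n≡j+ai)
                        (term-step-any X i j (suc m ∸ c * i) (sym (m∸n+n≡m ci≤1+m)) l≡X+j+di)
      where
      j = n ∸ a * i
      X = suc m ∸ n
      n≡j+ai : n ≡ j + a * i
      n≡j+ai = sym (m∸n+n≡m ai≤n)
      ci≤1+m : c * i ≤ suc m
      ci≤1+m = ≤-trans (*-monoˡ-≤ i c≤a) (≤-trans ai≤n n≤1+m)
      l≡X+j+di : suc m ∸ c * i ≡ X + j + d * i
      l≡X+j+di = +-cancelʳ-≡ (c * i) _ _ (begin
        suc m ∸ c * i + c * i   ≡⟨ m∸n+n≡m ci≤1+m ⟩
        suc m                   ≡⟨ m∸n+n≡m n≤1+m ⟨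
        X + n                   ≡⟨ cong (λ x → X + x) n≡j+ai ⟩
        X + (j + a * i)         ≡⟨ excess {X} {i} {j} refl ⟨
        X + j + d * i + c * i   ∎)

  patternTerm-no-room : ∀ {n m} i → ¬ a ≤ n → patternTerm n m i ≡ 0ℚ
  patternTerm-no-room         zero    _   = refl
  patternTerm-no-room {n} {m} (suc i) a≰n with a ≤? n
  ... | no  _   = refl
  ... | yes a≤n = contradiction a≤n a≰n

-- s_n(x) satisfies the recurrence

floor-bound : ∀ e n i → n DivMod./ suc e < i → n < suc (suc e) * i
floor-bound e n i n/[1+e]<i with ≤-<-connex (suc (suc e) * i) n
... | inj₂ n<ai = n<ai
... | inj₁ ai≤n = contradiction i≤n/[1+e] (<⇒≱ n/[1+e]<i)
  where
  i≤n/[1+e] : i ≤ n DivMod./ suc e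
  i≤n/[1+e] = subst (_≤ n DivMod./ suc e) (DivMod.m*n/n≡m i (suc e))
    (DivMod./-monoˡ-≤ (suc e) (≤-trans (≤-trans (*-monoʳ-≤ i (n≤1+n (suc e))) (≤-reflexive (*-comm i (suc (suc e))))) ai≤n))

-- With a = suc (suc e), the bound ⌊n / (a - 1)⌋ of the sum is n / suc e.
module FormulaRecurrence (e c : ℕ) (c≤a : c ≤ suc (suc e)) where
  open Terms (suc e) c

  private
    F : ℕ → ℕ → ℚ
    F = sFormula a c

  sFormula-as-sum : ∀ n m K → n DivMod./ suc e ≤ K → F n m ≡ sumTo K (term n m)
  sFormula-as-sum n m K n/[1+e]≤K = trans
    (*-distribˡ-sumTo (ι (+ m ℤ.- + n ℤ.+ + 1)) (n DivMod./ suc e) (summand a c n (+ m) (+ m ℤ.+ + n)))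
    (sym (sumTo-extend (n DivMod./ suc e) (term n m) (λ i lt → term-vanishes {n} {m} {i} (floor-bound e n i lt)) K n/[1+e]≤K))

  private
    sFormula-as-sum′ : ∀ n m K → n ≤ K → F n m ≡ sumTo K (term n m)
    sFormula-as-sum′ n m K n≤K = sFormula-as-sum n m K (≤-trans (DivMod.m/n≤m n (suc e)) n≤K)

    beforePattern-as-sum : ∀ n m → beforePattern a c F n m ≡ sumTo n (patternTerm n m)
    beforePattern-as-sum n m with a ≤? n
    ... | no  a≰n = sym (sumTo-zero n (λ i → patternTerm-no-room i a≰n))
    ... | yes a≤n@(s≤s {n = N} _) = begin
      F (n ∸ a) (m ∸ c)               ≡⟨ sFormula-as-sum′ (n ∸ a) (m ∸ c) N (m∸n≤m N (suc e)) ⟩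
      sumTo N (term (n ∸ a) (m ∸ c))  ≡⟨ sumTo-suc-shift N (patternTerm n m) (term (n ∸ a) (m ∸ c)) refl
                                           (λ i → patternTerm-suc {n} {m} {i} a≤n) ⟨
      sumTo n (patternTerm n m)       ∎

    left-as-sum : ∀ n m → left F n m ≡ sumTo n (leftTerm n m)
    left-as-sum zero    m = refl
    left-as-sum (suc n) m = sFormula-as-sum′ n m (suc n) (n≤1+n n)

  recurrence : Recurrence a c F
  recurrence = record
    { at-origin      = trans (sFormula-as-sum 0 0 0 z≤n)
                         (term-closed-form 0 0 0 1 (sym (*-zeroʳ a)) (sym (*-zeroʳ c))
                           (trans (cong (_+ 1) (*-zeroʳ c)) (sym (cong suc (*-zeroʳ a)))))
    ; below-diagonal = below-diagonal
    ; step           = step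
    }
    where
    below-diagonal : ∀ m → F (suc m) m ≡ 0ℚ
    below-diagonal m = trans (cong (λ z → ι z Q.* S) (+m-+n+1≡+P {m} {suc m} {0} (+-comm m 1))) (QP.*-zeroˡ S)
      where S = sumTo (suc m DivMod./ suc e) (summand a c (suc m) (+ m) (+ m ℤ.+ + suc m))
    step : ∀ n m → n ≤ suc m → F n (suc m) Q.+ beforePattern a c F n (suc m) ≡ F n m Q.+ left F n (suc m)
    step n m n≤1+m = begin
      F n (suc m) Q.+ beforePattern a c F n (suc m)
        ≡⟨ cong₂ Q._+_ (sFormula-as-sum′ n (suc m) n ≤-refl) (beforePattern-as-sum n (suc m)) ⟩
      sumTo n (term n (suc m)) Q.+ sumTo n (patternTerm n (suc m))
        ≡⟨ sumTo-+ n (term n (suc m)) (patternTerm n (suc m)) ⟨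
      sumTo n (λ i → term n (suc m) i Q.+ patternTerm n (suc m) i)
        ≡⟨ sumTo-cong n (λ i → term-recurrence c≤a n m i n≤1+m) ⟩
      sumTo n (λ i → term n m i Q.+ leftTerm n (suc m) i)
        ≡⟨ sumTo-+ n (term n m) (leftTerm n (suc m)) ⟩
      sumTo n (term n m) Q.+ sumTo n (leftTerm n (suc m))
        ≡⟨ cong₂ Q._+_ (sFormula-as-sum′ n m n ≤-refl) (left-as-sum n (suc m)) ⟨
      F n m Q.+ left F n (suc m)
        ∎

sFormula-recurrence : ∀ {a c} → 2 ≤ a → c ≤ a → Recurrence a c (sFormula a c)
sFormula-recurrence {suc (suc e)} {c} (s≤s (s≤s z≤n)) c≤a = FormulaRecurrence.recurrence e c c≤a

𝟙 : ∀ {P : Set} → Dec P → ℕ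
𝟙 (yes _) = 1
𝟙 (no  _) = 0

𝟙-yes : ∀ {P : Set} (P? : Dec P) → P → 𝟙 P? ≡ 1
𝟙-yes (yes _) _ = refl
𝟙-yes (no ¬p) p = contradiction p ¬p

𝟙-no : ∀ {P : Set} (P? : Dec P) → ¬ P → 𝟙 P? ≡ 0
𝟙-no (yes p) ¬p = contradiction p ¬p
𝟙-no (no _)  _  = refl

𝟙-cong : ∀ {P Q : Set} (P? : Dec P) (Q? : Dec Q) → (P → Q) → (Q → P) → 𝟙 P? ≡ 𝟙 Q?
𝟙-cong (yes p) Q? to _    = sym (𝟙-yes Q? (to p))
𝟙-cong (no ¬p) Q? _  from = sym (𝟙-no Q? (λ q → ¬p (from q)))

𝟙-⊎ : ∀ {P Q R : Set} (P? : Dec P) (Q? : Dec Q) (R? : Dec R) →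
      (P ⊎ Q → R) → (R → P ⊎ Q) → ¬ (P × Q) → 𝟙 P? + 𝟙 Q? ≡ 𝟙 R?
𝟙-⊎ (yes p) (yes q) _       _  _  ¬pq = contradiction (p , q) ¬pq
𝟙-⊎ (yes p) (no _)  R?      to _  _   = sym (𝟙-yes R? (to (inj₁ p)))
𝟙-⊎ (no _)  (yes q) R?      to _  _   = sym (𝟙-yes R? (to (inj₂ q)))
𝟙-⊎ (no ¬p) (no ¬q) R?      _  from _ = sym (𝟙-no R? λ r → [ ¬p , ¬q ]′ (from r))

∑ : List Word → (Word → ℕ) → ℕ
∑ []       f = 0
∑ (w ∷ ws) f = f w + ∑ ws f

syntax ∑ ws (λ w → e) = ∑[ w ∈ ws ] e

∑-++ : ∀ xs ys f → ∑ (xs ++ ys) f ≡ ∑ xs f + ∑ ys f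
∑-++ []       ys f = refl
∑-++ (x ∷ xs) ys f = trans (cong (λ t → f x + t) (∑-++ xs ys f)) (sym (+-assoc (f x) _ _))

∑-map : ∀ g ws f → ∑ (map g ws) f ≡ ∑[ w ∈ ws ] f (g w)
∑-map g []       f = refl
∑-map g (w ∷ ws) f = cong (λ t → f (g w) + t) (∑-map g ws f)

∑-congᴬ : ∀ {ws f g} → All (λ w → f w ≡ g w) ws → ∑ ws f ≡ ∑ ws g
∑-congᴬ []           = refl
∑-congᴬ (eq ∷ eqs) = cong₂ _+_ eq (∑-congᴬ eqs)

∑-cong : ∀ ws {f g} → (∀ w → f w ≡ g w) → ∑ ws f ≡ ∑ ws g
∑-cong ws f≗g = ∑-congᴬ {ws} (All.tabulate λ {w} _ → f≗g w)

∑-zero : ∀ ws {f} → (∀ w → f w ≡ 0) → ∑ ws f ≡ 0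
∑-zero []       f≡0 = refl
∑-zero (w ∷ ws) f≡0 = cong₂ _+_ (f≡0 w) (∑-zero ws f≡0)

∑-+ : ∀ ws f g → ∑[ w ∈ ws ] (f w + g w) ≡ ∑ ws f + ∑ ws g
∑-+ []       f g = refl
∑-+ (w ∷ ws) f g = trans (cong (λ t → f w + g w + t) (∑-+ ws f g)) (regroup (f w) (g w) (∑ ws f) (∑ ws g))
  where
  regroup : ∀ a b c d → a + b + (c + d) ≡ a + c + (b + d)
  regroup = ℕ-Solver.solve-∀

*-distribˡ-∑ : ∀ k ws f → ∑[ w ∈ ws ] (k * f w) ≡ k * ∑ ws f
*-distribˡ-∑ k []       f = sym (*-zeroʳ k)
*-distribˡ-∑ k (w ∷ ws) f = trans (cong (λ t → k * f w + t) (*-distribˡ-∑ k ws f)) (sym (*-distribˡ-+ k (f w) _))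

words-length : ∀ N → All (λ w → length w ≡ N) (words N)
words-length zero    = refl ∷ []
words-length (suc N) = All.++⁺ (All.map⁺ (All.map (cong suc) (words-length N)))
                               (All.map⁺ (All.map (cong suc) (words-length N)))

∑-words-++ : ∀ j L f → ∑ (words (j + L)) f ≡ ∑[ w ∈ words j ] ∑[ s ∈ words L ] f (w ++ s)
∑-words-++ zero    L f = sym (+-identityʳ _)
∑-words-++ (suc j) L f = begin
  ∑ (map (u ∷_) W ++ map (r ∷_) W) f
    ≡⟨ ∑-++ (map (u ∷_) W) _ f ⟩
  ∑ (map (u ∷_) W) f + ∑ (map (r ∷_) W) f
    ≡⟨ cong₂ _+_ (∑-map (u ∷_) W f) (∑-map (r ∷_) W f) ⟩
  ∑[ v ∈ W ] f (u ∷ v) + ∑[ v ∈ W ] f (r ∷ v)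
    ≡⟨ cong₂ _+_ (∑-words-++ j L (λ v → f (u ∷ v))) (∑-words-++ j L (λ v → f (r ∷ v))) ⟩
  ∑[ w ∈ Wⱼ ] g (u ∷ w) + ∑[ w ∈ Wⱼ ] g (r ∷ w)
    ≡⟨ cong₂ _+_ (∑-map (u ∷_) Wⱼ g) (∑-map (r ∷_) Wⱼ g) ⟨
  ∑ (map (u ∷_) Wⱼ) g + ∑ (map (r ∷_) Wⱼ) g
    ≡⟨ ∑-++ (map (u ∷_) Wⱼ) _ g ⟨
  ∑ (words (suc j)) g
    ∎
  where
  W = words (j + L)
  Wⱼ = words j
  g = λ w → ∑[ s ∈ words L ] f (w ++ s)

∑-words-∷ʳ : ∀ k f → ∑ (words (suc k)) f ≡ ∑[ w ∈ words k ] (f (w ∷ʳ u) + f (w ∷ʳ r))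
∑-words-∷ʳ k f = begin
  ∑ (words (suc k)) f                        ≡⟨ cong (λ N → ∑ (words N) f) (+-comm 1 k) ⟩
  ∑ (words (k + 1)) f                        ≡⟨ ∑-words-++ k 1 f ⟩
  ∑[ w ∈ words k ] (f (w ∷ʳ u) + (f (w ∷ʳ r) + 0)) ≡⟨ ∑-cong (words k) (λ w → cong (λ t → f (w ∷ʳ u) + t) (+-identityʳ _)) ⟩
  ∑[ w ∈ words k ] (f (w ∷ʳ u) + f (w ∷ʳ r))  ∎

_≟W_ : (v w : Word) → Dec (v ≡ w)
_≟W_ = List.≡-dec _≟S_

∑-words-≡ : ∀ p → ∑[ s ∈ words (length p) ] 𝟙 (s ≟W p) ≡ 1
∑-words-≡ []      = refl
∑-words-≡ (x ∷ p) = begin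
  ∑ (map (u ∷_) W ++ map (r ∷_) W) f
    ≡⟨ ∑-++ (map (u ∷_) W) _ f ⟩
  ∑ (map (u ∷_) W) f + ∑ (map (r ∷_) W) f
    ≡⟨ cong₂ _+_ (∑-map (u ∷_) W f) (∑-map (r ∷_) W f) ⟩
  ∑[ s ∈ W ] f (u ∷ s) + ∑[ s ∈ W ] f (r ∷ s)
    ≡⟨ cong₂ _+_ (first-letter u) (first-letter r) ⟩
  𝟙 (u ≟S x) + 𝟙 (r ≟S x)
    ≡⟨ exactly-one x ⟩
  1 ∎
  where
  W = words (length p)
  f = λ s → 𝟙 (s ≟W (x ∷ p))
  first-letter : ∀ y → ∑[ s ∈ W ] f (y ∷ s) ≡ 𝟙 (y ≟S x)
  first-letter y = by-letter (y ≟S x)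
    where
    by-letter : (y≟x : Dec (y ≡ x)) → ∑[ s ∈ W ] f (y ∷ s) ≡ 𝟙 y≟x
    by-letter (yes refl) = trans (∑-cong W λ s → 𝟙-cong _ _ List.∷-injectiveʳ (cong (y ∷_))) (∑-words-≡ p)
    by-letter (no y≢x)   = ∑-zero W λ s → 𝟙-no ((y ∷ s) ≟W (x ∷ p)) λ eq → y≢x (List.∷-injectiveˡ eq)
  exactly-one : ∀ x → 𝟙 (u ≟S x) + 𝟙 (r ≟S x) ≡ 1
  exactly-one u = refl
  exactly-one r = refl

#r-++ : ∀ v w → #r (v ++ w) ≡ #r v + #r w
#r-++ []      w = refl
#r-++ (u ∷ v) w = #r-++ v w
#r-++ (r ∷ v) w = cong suc (#r-++ v w)

#u-++ : ∀ v w → #u (v ++ w) ≡ #u v + #u w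
#u-++ []      w = refl
#u-++ (u ∷ v) w = cong suc (#u-++ v w)
#u-++ (r ∷ v) w = #u-++ v w

length≡#r+#u : ∀ w → length w ≡ #r w + #u w
length≡#r+#u []      = refl
length≡#r+#u (u ∷ w) = trans (cong suc (length≡#r+#u w)) (sym (+-suc (#r w) (#u w)))
length≡#r+#u (r ∷ w) = cong suc (length≡#r+#u w)

++-split : ∀ (v w x y : Word) → v ++ w ≡ x ++ y →
           (∃[ t ] x ≡ v ++ t × w ≡ t ++ y) ⊎ (∃[ t ] v ≡ x ++ t × y ≡ t ++ w)
++-split []      w x       y eq = inj₁ (x , refl , eq)
++-split (s ∷ v) w []      y eq = inj₂ (s ∷ v , refl , sym eq)
++-split (s ∷ v) w (s′ ∷ x) y eq with List.∷-injective eq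
... | refl , eq′ with ++-split v w x y eq′
...   | inj₁ (t , x≡vt , w≡ty) = inj₁ (t , cong (s ∷_) x≡vt , w≡ty)
...   | inj₂ (t , v≡xt , y≡tw) = inj₂ (t , cong (s ∷_) v≡xt , y≡tw)

occurs⇒split : ∀ {p w} → Occurs p w → ∃[ xs ] ∃[ ys ] w ≡ xs ++ p ++ ys
occurs⇒split occ with toView occ
... | MkView xs p≋ ys rewrite Pointwise-≡⇒≡ p≋ = xs , ys , refl

split⇒occurs : ∀ {p w} xs ys → w ≡ xs ++ p ++ ys → Occurs p w
split⇒occurs xs ys refl = fromView (MkView xs (≡⇒Pointwise-≡ refl) ys)

∷ʳ-∉-[] : ∀ q x → Avoids (q ∷ʳ x) []
∷ʳ-∉-[] []      x (here ())
∷ʳ-∉-[] (y ∷ q) x (here ())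

occurs-++ʳ : ∀ {p} w v → Occurs p w → Occurs p (w ++ v)
occurs-++ʳ {p} w v occ with occurs⇒split occ
... | xs , ys , refl = split⇒occurs xs (ys ++ v) (trans (List.++-assoc xs (p ++ ys) v) (cong (xs ++_) (List.++-assoc p ys v)))

occurs-suffix : ∀ {p} w → Occurs p (w ++ p)
occurs-suffix {p} w = split⇒occurs w [] (cong (w ++_) (sym (List.++-identityʳ p)))

avoids-∷ʳ-occurs : ∀ {p} w x → Avoids p w → Occurs p (w ∷ʳ x) → ∃[ w′ ] w ∷ʳ x ≡ w′ ++ p
avoids-∷ʳ-occurs {p} w x p∉w occ with occurs⇒split occ
... | xs , ys , eq with initLast ys
...   | []       = xs , trans eq (cong (xs ++_) (List.++-identityʳ p))
...   | zs ∷ʳ′ z = contradiction (split⇒occurs xs zs (proj₁ (List.∷ʳ-injective w _ eq′))) p∉w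
  where
  eq′ : w ∷ʳ x ≡ (xs ++ p ++ zs) ∷ʳ z
  eq′ = begin
    w ∷ʳ x                ≡⟨ eq ⟩
    xs ++ p ++ zs ∷ʳ z    ≡⟨ cong (xs ++_) (List.++-assoc p zs _) ⟨
    xs ++ (p ++ zs) ∷ʳ z  ≡⟨ List.++-assoc xs (p ++ zs) _ ⟨
    (xs ++ p ++ zs) ∷ʳ z  ∎

private
  ∷ʳ-not-in-init : ∀ {p q : Word} {x : Step} (t ys : Word) → p ≡ q ∷ʳ x → q ≡ t ++ p ++ ys → ⊥
  ∷ʳ-not-in-init {p} {q} t ys p≡qx q≡t·p·ys = <-irrefl refl (<-≤-trans |q|<|p| |p|≤|q|)
    where
    |q|<|p| : length q < length p
    |q|<|p| = ≤-reflexive (sym (trans (cong length p≡qx) (trans (List.length-++ q) (+-comm (length q) 1))))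
    |p|≤|q| : length p ≤ length q
    |p|≤|q| = ≤-trans (m≤m+n (length p) (length ys))
                (≤-trans (m≤n+m _ (length t))
                  (≤-reflexive (sym (trans (cong length q≡t·p·ys)
                    (trans (List.length-++ t) (cong (λ k → length t + k) (List.length-++ p)))))))

  nonEmpty-∷ʳ : ∀ ys x → NonEmpty (ys ∷ʳ x)
  nonEmpty-∷ʳ []       x = x , [] , refl
  nonEmpty-∷ʳ (y ∷ ys) x = y , ys ∷ʳ x , refl

bifixFree-avoids-++-init : ∀ {p q x} → p ≡ q ∷ʳ x → BifixFree p → ∀ w → Avoids p w → Avoids p (w ++ q)
bifixFree-avoids-++-init {p} {q} {x} p≡qx bf w p∉w occ with occurs⇒split occ
... | xs , ys , wq≡xs·p·ys with ++-split w q xs (p ++ ys) wq≡xs·p·ys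
...   | inj₁ (t , _ , q≡t·p·ys) = ∷ʳ-not-in-init t ys p≡qx q≡t·p·ys
...   | inj₂ ([] , _ , p·ys≡q) = ∷ʳ-not-in-init [] ys p≡qx (sym p·ys≡q)
...   | inj₂ (t@(t₀ ∷ t₁) , w≡xs·t , p·ys≡t·q) with ++-split p ys t q p·ys≡t·q
...     | inj₁ (t′ , t≡p·t′ , _) = p∉w (split⇒occurs xs t′ (trans w≡xs·t (cong (xs ++_) t≡p·t′)))
...     | inj₂ ([] , p≡t , _) =
          p∉w (split⇒occurs xs [] (trans w≡xs·t (cong (xs ++_) (trans (sym (trans p≡t (List.++-identityʳ t))) (sym (List.++-identityʳ p))))))
...     | inj₂ (o@(o₀ ∷ o₁) , p≡t·o , q≡o·ys) =
          bf (o , (o₀ , o₁ , refl) , ys ∷ʳ x , t , nonEmpty-∷ʳ ys x , (t₀ , t₁ , refl) ,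
              trans p≡qx (trans (cong (_∷ʳ x) q≡o·ys) (List.++-assoc o ys _)) , p≡t·o)

All-inits⇒prefixes : ∀ {P : Word → Set} w → All P (inits w) → ∀ q s → w ≡ q ++ s → P q
All-inits⇒prefixes []      (p[] ∷ _) []      s _  = p[]
All-inits⇒prefixes (x ∷ w) (p[] ∷ _) []      s _  = p[]
All-inits⇒prefixes {P} (x ∷ w) (_ ∷ ps) (y ∷ q) s eq with List.∷-injective eq
... | refl , w≡qs = All-inits⇒prefixes {P ∘ (x ∷_)} w (All.map⁻ ps) q s w≡qs

prefixes⇒All-inits : ∀ {P : Word → Set} w → (∀ q s → w ≡ q ++ s → P q) → All P (inits w)
prefixes⇒All-inits []      h = h [] [] refl ∷ []
prefixes⇒All-inits (x ∷ w) h =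
  h [] (x ∷ w) refl ∷ All.map⁺ (prefixes⇒All-inits w (λ q s w≡qs → h (x ∷ q) s (cong (x ∷_) w≡qs)))

ballot-++⁻ : ∀ v w → Ballot (v ++ w) → Ballot v
ballot-++⁻ v w bal = prefixes⇒All-inits v λ q s v≡qs →
  All-inits⇒prefixes (v ++ w) bal q (s ++ w) (trans (cong (_++ w) v≡qs) (List.++-assoc q s w))

ballot-++⁺ : ∀ v w → Ballot v → (∀ q s → w ≡ q ++ s → #r (v ++ q) ≤ #u (v ++ q)) → Ballot (v ++ w)
ballot-++⁺ v w bal ext = prefixes⇒All-inits (v ++ w) λ q s vw≡qs → case (++-split v w q s vw≡qs)
  where
  case : ∀ {q s} → (∃[ t ] q ≡ v ++ t × w ≡ t ++ s) ⊎ (∃[ t ] v ≡ q ++ t × s ≡ t ++ w) → #r q ≤ #u q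
  case (inj₁ (t , refl , w≡ts)) = ext t _ w≡ts
  case (inj₂ (t , v≡qt , _))    = All-inits⇒prefixes v bal _ t v≡qt

depthZero-suffix : ∀ q s → DepthZero (q ++ s) → #u s ≤ #r s
depthZero-suffix []      []      (h ∷ _)  = h
depthZero-suffix []      (x ∷ s) (h ∷ _)  = h
depthZero-suffix (x ∷ q) s       (_ ∷ hs) = depthZero-suffix q s hs

ballot-endpoint : ∀ {w} → Ballot w → #r w ≤ #u w
ballot-endpoint {w} bal = All-inits⇒prefixes w bal w [] (sym (List.++-identityʳ w))

length-filter≡∑𝟙 : ∀ {P : Word → Set} (P? : ∀ w → Dec (P w)) ws → length (filter P? ws) ≡ ∑[ w ∈ ws ] 𝟙 (P? w)
length-filter≡∑𝟙 P? []       = refl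
length-filter≡∑𝟙 P? (w ∷ ws) with P? w
... | yes _ = cong suc (length-filter≡∑𝟙 P? ws)
... | no  _ = length-filter≡∑𝟙 P? ws

𝟙-× : ∀ {P Q : Set} (P? : Dec P) (Q? : Dec Q) → 𝟙 (P? ×-dec Q?) ≡ 𝟙 P? * 𝟙 Q?
𝟙-× (yes _) (yes _) = refl
𝟙-× (yes _) (no _)  = refl
𝟙-× (no _)  _       = refl

take-length-++ : ∀ (v w : Word) → take (length v) (v ++ w) ≡ v
take-length-++ []      w = refl
take-length-++ (x ∷ v) w = cong (x ∷_) (take-length-++ v w)

drop-length-++ : ∀ (v w : Word) → drop (length v) (v ++ w) ≡ w
drop-length-++ []      w = refl
drop-length-++ (x ∷ v) w = drop-length-++ v w

++-length-injective : ∀ {v w x y : Word} → length v ≡ length w → v ++ x ≡ w ++ y → v ≡ w × x ≡ y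
++-length-injective {[]}    {[]}    _       eq = refl , eq
++-length-injective {x ∷ v} {y ∷ w} |v|≡|w| eq with List.∷-injective eq
... | refl , eq′ with ++-length-injective {v} {w} (suc-injective |v|≡|w|) eq′
...   | refl , x≡y = refl , x≡y

#r-∷ʳ-u : ∀ w → #r (w ∷ʳ u) ≡ #r w
#r-∷ʳ-u w = trans (#r-++ w (u ∷ [])) (+-identityʳ (#r w))

#u-∷ʳ-u : ∀ w → #u (w ∷ʳ u) ≡ suc (#u w)
#u-∷ʳ-u w = trans (#u-++ w (u ∷ [])) (+-comm (#u w) 1)

#r-∷ʳ-r : ∀ w → #r (w ∷ʳ r) ≡ suc (#r w)
#r-∷ʳ-r w = trans (#r-++ w (r ∷ [])) (+-comm (#r w) 1)

#u-∷ʳ-r : ∀ w → #u (w ∷ʳ r) ≡ #u w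
#u-∷ʳ-r w = trans (#u-++ w (r ∷ [])) (+-identityʳ (#u w))

count : Word → ℕ → ℕ → ℕ
count p n m = ∑[ w ∈ words (n + m) ] 𝟙 (counted? p n m w)

s≡count : ∀ p n m → s p n m ≡ count p n m
s≡count p n m = length-filter≡∑𝟙 (counted? p n m) (words (n + m))

-- s_n(m) satisfies the recurrence

module PathCounting (p : Word) (dz : DepthZero p) (bf : BifixFree p) (q₀ : Word) (x₀ : Step)
                    (p≡q₀x₀ : p ≡ q₀ ∷ʳ x₀) where
  a c : ℕ
  a = #r p
  c = #u p

  c≤a : c ≤ a
  c≤a = depthZero-suffix [] p dz

  -- w is counted at the point from which the step x leads to (n, m).
  CountedBefore : Step → ℕ → ℕ → Word → Set
  CountedBefore u n       zero    w = ⊥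
  CountedBefore u n       (suc m) w = Counted p n m w
  CountedBefore r zero    m       w = ⊥
  CountedBefore r (suc n) m       w = Counted p n m w

  countedBefore? : ∀ x n m w → Dec (CountedBefore x n m w)
  countedBefore? u n       zero    w = no λ ()
  countedBefore? u n       (suc m) w = counted? p n m w
  countedBefore? r zero    m       w = no λ ()
  countedBefore? r (suc n) m       w = counted? p n m w

  -- The conjunct a ≤ n excludes the truncated subtraction n ∸ a.
  EndsWithPattern : ℕ → ℕ → Word → Set
  EndsWithPattern n m v = a ≤ n × ∃[ w ] v ≡ w ++ p × Counted p (n ∸ a) (m ∸ c) w

  endsWithPattern? : ∀ n m v → Dec (EndsWithPattern n m v)
  endsWithPattern? n m v = (a ≤? n) ×-dec map′ split join (counted? p (n ∸ a) (m ∸ c) (take j v) ×-dec (drop j v ≟W p))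
    where
    j = (n ∸ a) + (m ∸ c)
    split : Counted p (n ∸ a) (m ∸ c) (take j v) × drop j v ≡ p → ∃[ w ] v ≡ w ++ p × Counted p (n ∸ a) (m ∸ c) w
    split (counted , drop≡p) = take j v , trans (sym (List.take++drop≡id j v)) (cong (take j v ++_) drop≡p) , counted
    join : ∃[ w ] v ≡ w ++ p × Counted p (n ∸ a) (m ∸ c) w → Counted p (n ∸ a) (m ∸ c) (take j v) × drop j v ≡ p
    join (w , refl , counted@(_ , (#r≡ , #u≡) , _)) =
      subst (Counted p (n ∸ a) (m ∸ c)) (sym (subst (λ k → take k (w ++ p) ≡ w) |w|≡j (take-length-++ w p))) counted ,
      subst (λ k → drop k (w ++ p) ≡ p) |w|≡j (drop-length-++ w p)
      where
      |w|≡j : length w ≡ j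
      |w|≡j = trans (length≡#r+#u w) (cong₂ _+_ #r≡ #u≡)

  countedBefore⇒ : ∀ x n m w → CountedBefore x n m w → Ballot w × EndsAt n m (w ∷ʳ x) × Avoids p w
  countedBefore⇒ u n (suc m) w (bal , (#r≡n , #u≡m) , p∉w) =
    bal , (trans (#r-∷ʳ-u w) #r≡n , trans (#u-∷ʳ-u w) (cong suc #u≡m)) , p∉w
  countedBefore⇒ r (suc n) m w (bal , (#r≡n , #u≡m) , p∉w) =
    bal , (trans (#r-∷ʳ-r w) (cong suc #r≡n) , trans (#u-∷ʳ-r w) #u≡m) , p∉w

  ⇒countedBefore : ∀ x n m w → Ballot w → EndsAt n m (w ∷ʳ x) → Avoids p w → CountedBefore x n m w
  ⇒countedBefore u n zero    w _   (_ , #u≡0) _   = contradiction (trans (sym (#u-∷ʳ-u w)) #u≡0) λ ()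
  ⇒countedBefore u n (suc m) w bal (#r≡n , #u≡1+m) p∉w =
    bal , (trans (sym (#r-∷ʳ-u w)) #r≡n , suc-injective (trans (sym (#u-∷ʳ-u w)) #u≡1+m)) , p∉w
  ⇒countedBefore r zero    m w _   (#r≡0 , _) _   = contradiction (trans (sym (#r-∷ʳ-r w)) #r≡0) λ ()
  ⇒countedBefore r (suc n) m w bal (#r≡1+n , #u≡m) p∉w =
    bal , (suc-injective (trans (sym (#r-∷ʳ-r w)) #r≡1+n) , trans (sym (#u-∷ʳ-r w)) #u≡m) , p∉w

  counted-∷ʳ⇒countedBefore : ∀ {n m} x w → Counted p n m (w ∷ʳ x) → CountedBefore x n m w
  counted-∷ʳ⇒countedBefore {n} {m} x w (bal , ends , p∉wx) =
    ⇒countedBefore x n m w (ballot-++⁻ w _ bal) ends (λ occ → p∉wx (occurs-++ʳ w _ occ))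

  counted⇒¬endsWithPattern : ∀ {n m v} → Counted p n m v → ¬ EndsWithPattern n m v
  counted⇒¬endsWithPattern (_ , _ , p∉v) (_ , w , refl , _) = p∉v (occurs-suffix w)

  -- Removing the last letter from w·p leaves w·q₀, which is p-free since p is bifix-free,
  -- and is ballot since p has depth zero and (n, m) lies weakly above the diagonal.
  endsWithPattern⇒countedBefore : ∀ {n m} x w → n ≤ m → EndsWithPattern n m (w ∷ʳ x) → CountedBefore x n m w
  endsWithPattern⇒countedBefore {n} {m} x w n≤m (a≤n , w′ , wx≡w′p , bal′ , (#r≡ , #u≡) , p∉w′) =
    ⇒countedBefore x n m w ballot (#r-wx , #u-wx) p∉w
    where
    wx≡w′q₀x₀ : w ∷ʳ x ≡ (w′ ++ q₀) ∷ʳ x₀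
    wx≡w′q₀x₀ = trans wx≡w′p (trans (cong (w′ ++_) p≡q₀x₀) (sym (List.++-assoc w′ q₀ _)))
    w≡w′q₀ : w ≡ w′ ++ q₀
    w≡w′q₀ = proj₁ (List.∷ʳ-injective w _ wx≡w′q₀x₀)
    #r-wx : #r (w ∷ʳ x) ≡ n
    #r-wx = trans (cong #r wx≡w′p) (trans (#r-++ w′ p) (trans (cong (_+ a) #r≡) (m∸n+n≡m a≤n)))
    #u-wx : #u (w ∷ʳ x) ≡ m
    #u-wx = trans (cong #u wx≡w′p) (trans (#u-++ w′ p) (trans (cong (_+ c) #u≡) (m∸n+n≡m (≤-trans c≤a (≤-trans a≤n n≤m)))))
    p∉w : Avoids p w
    p∉w = subst (Avoids p) (sym w≡w′q₀) (bifixFree-avoids-++-init p≡q₀x₀ bf w′ p∉w′)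
    ballot : Ballot w
    ballot = subst Ballot (sym w≡w′q₀) (ballot-++⁺ w′ q₀ bal′ prefix-ok)
      where
      prefix-ok : ∀ q s → q₀ ≡ q ++ s → #r (w′ ++ q) ≤ #u (w′ ++ q)
      prefix-ok q s q₀≡qs = +-cancelʳ-≤ (#r S) (#r (w′ ++ q)) (#u (w′ ++ q))
        (≤-trans (≤-reflexive r-count) (≤-trans n≤m (≤-trans (≤-reflexive (sym u-count))
          (+-monoʳ-≤ (#u (w′ ++ q)) (depthZero-suffix q S (subst DepthZero p≡qS dz))))))
        where
        S = s ∷ʳ x₀
        p≡qS : p ≡ q ++ S
        p≡qS = trans p≡q₀x₀ (trans (cong (_∷ʳ x₀) q₀≡qs) (List.++-assoc q s _))
        w′qS≡wx : (w′ ++ q) ++ S ≡ w ∷ʳ x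
        w′qS≡wx = trans (List.++-assoc w′ q S) (trans (cong (w′ ++_) (sym p≡qS)) (sym wx≡w′p))
        r-count : #r (w′ ++ q) + #r S ≡ n
        r-count = trans (sym (#r-++ (w′ ++ q) S)) (trans (cong #r w′qS≡wx) #r-wx)
        u-count : #u (w′ ++ q) + #u S ≡ m
        u-count = trans (sym (#u-++ (w′ ++ q) S)) (trans (cong #u w′qS≡wx) #u-wx)

  countedBefore⇒counted : ∀ {n m} x w → n ≤ m → CountedBefore x n m w → ¬ EndsWithPattern n m (w ∷ʳ x) →
                          Counted p n m (w ∷ʳ x)
  countedBefore⇒counted {n} {m} x w n≤m before ¬ends = ballot-wx , ends-wx , p∉wx
    where
    ballot-w = proj₁ (countedBefore⇒ x n m w before)
    ends-wx = proj₁ (proj₂ (countedBefore⇒ x n m w before))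
    p∉w = proj₂ (proj₂ (countedBefore⇒ x n m w before))
    ballot-wx : Ballot (w ∷ʳ x)
    ballot-wx = ballot-++⁺ w (x ∷ []) ballot-w prefix-ok
      where
      prefix-ok : ∀ q s → x ∷ [] ≡ q ++ s → #r (w ++ q) ≤ #u (w ++ q)
      prefix-ok []          s _  = subst (λ v → #r v ≤ #u v) (sym (List.++-identityʳ w)) (ballot-endpoint ballot-w)
      prefix-ok (y ∷ [])    s eq with List.∷-injective eq
      ... | refl , _ = subst₂ _≤_ (sym (proj₁ ends-wx)) (sym (proj₂ ends-wx)) n≤m
      prefix-ok (_ ∷ _ ∷ _) s ()
    p∉wx : Avoids p (w ∷ʳ x)
    p∉wx occ with avoids-∷ʳ-occurs w x p∉w occ
    ... | w′ , wx≡w′p = ¬ends (a≤n , w′ , wx≡w′p , ballot-w′ , (#r-w′ , #u-w′) , p∉w′)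
      where
      w≡w′q₀ : w ≡ w′ ++ q₀
      w≡w′q₀ = proj₁ (List.∷ʳ-injective w _ (trans wx≡w′p (trans (cong (w′ ++_) p≡q₀x₀) (sym (List.++-assoc w′ q₀ _)))))
      #r-w′p : #r w′ + a ≡ n
      #r-w′p = trans (sym (#r-++ w′ p)) (trans (cong #r (sym wx≡w′p)) (proj₁ ends-wx))
      #u-w′p : #u w′ + c ≡ m
      #u-w′p = trans (sym (#u-++ w′ p)) (trans (cong #u (sym wx≡w′p)) (proj₂ ends-wx))
      a≤n : a ≤ n
      a≤n = subst (a ≤_) #r-w′p (m≤n+m a (#r w′))
      #r-w′ : #r w′ ≡ n ∸ a
      #r-w′ = trans (sym (m+n∸n≡m (#r w′) a)) (cong (_∸ a) #r-w′p)
      #u-w′ : #u w′ ≡ m ∸ c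
      #u-w′ = trans (sym (m+n∸n≡m (#u w′) c)) (cong (_∸ c) #u-w′p)
      ballot-w′ : Ballot w′
      ballot-w′ = ballot-++⁻ w′ p (subst Ballot wx≡w′p ballot-wx)
      p∉w′ : Avoids p w′
      p∉w′ occ′ = p∉w (subst (Occurs p) (sym w≡w′q₀) (occurs-++ʳ w′ q₀ occ′))

  𝟙-counted+𝟙-endsWithPattern : ∀ {n m} x w → n ≤ m →
    𝟙 (counted? p n m (w ∷ʳ x)) + 𝟙 (endsWithPattern? n m (w ∷ʳ x)) ≡ 𝟙 (countedBefore? x n m w)
  𝟙-counted+𝟙-endsWithPattern {n} {m} x w n≤m = 𝟙-⊎ (counted? p n m (w ∷ʳ x)) (endsWithPattern? n m (w ∷ʳ x)) (countedBefore? x n m w)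
    [ counted-∷ʳ⇒countedBefore x w , endsWithPattern⇒countedBefore x w n≤m ]′
    from
    (λ (counted , ends) → counted⇒¬endsWithPattern counted ends)
    where
    from : CountedBefore x n m w → Counted p n m (w ∷ʳ x) ⊎ EndsWithPattern n m (w ∷ʳ x)
    from before with endsWithPattern? n m (w ∷ʳ x)
    ... | yes ends = inj₂ ends
    ... | no ¬ends = inj₁ (countedBefore⇒counted x w n≤m before ¬ends)

  endsCount : ℕ → ℕ → ℕ
  endsCount n m = ∑[ v ∈ words (n + m) ] 𝟙 (endsWithPattern? n m v)

  count-step : ∀ n m → n ≤ suc m →
    count p n (suc m) + endsCount n (suc m) ≡ count p n m + ∑[ w ∈ words (n + m) ] 𝟙 (countedBefore? r n (suc m) w)
  count-step n m n≤1+m = begin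
    count p n (suc m) + endsCount n (suc m)
      ≡⟨ ∑-+ (words (n + suc m)) Iᶜ Iᵉ ⟨
    ∑[ v ∈ words (n + suc m) ] (Iᶜ v + Iᵉ v)
      ≡⟨ cong (λ k → ∑[ v ∈ words k ] (Iᶜ v + Iᵉ v)) (+-suc n m) ⟩
    ∑[ v ∈ words (suc (n + m)) ] (Iᶜ v + Iᵉ v)
      ≡⟨ ∑-words-∷ʳ (n + m) (λ v → Iᶜ v + Iᵉ v) ⟩
    ∑[ w ∈ words (n + m) ] ((Iᶜ (w ∷ʳ u) + Iᵉ (w ∷ʳ u)) + (Iᶜ (w ∷ʳ r) + Iᵉ (w ∷ʳ r)))
      ≡⟨ ∑-cong (words (n + m)) (λ w → cong₂ _+_ (𝟙-counted+𝟙-endsWithPattern u w n≤1+m)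
                                                 (𝟙-counted+𝟙-endsWithPattern r w n≤1+m)) ⟩
    ∑[ w ∈ words (n + m) ] (Iᵇ u w + Iᵇ r w)
      ≡⟨ ∑-+ (words (n + m)) (Iᵇ u) (Iᵇ r) ⟩
    count p n m + ∑[ w ∈ words (n + m) ] Iᵇ r w
      ∎
    where
    Iᶜ = λ v → 𝟙 (counted? p n (suc m) v)
    Iᵉ = λ v → 𝟙 (endsWithPattern? n (suc m) v)
    Iᵇ = λ x w → 𝟙 (countedBefore? x n (suc m) w)

  endsCount-no-room : ∀ {n m} → ¬ a ≤ n → endsCount n m ≡ 0
  endsCount-no-room {n} {m} a≰n = ∑-zero (words (n + m)) λ v → 𝟙-no (endsWithPattern? n m v) (a≰n ∘ proj₁)

  endsCount-room : ∀ {n m} → a ≤ n → c ≤ m → endsCount n m ≡ count p (n ∸ a) (m ∸ c)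
  endsCount-room {n} {m} a≤n c≤m = begin
    ∑[ v ∈ words (n + m) ] E v
      ≡⟨ cong (λ k → ∑[ v ∈ words k ] E v) n+m≡j+|p| ⟩
    ∑[ v ∈ words (j + length p) ] E v
      ≡⟨ ∑-words-++ j (length p) E ⟩
    ∑[ w ∈ words j ] ∑[ s ∈ words (length p) ] E (w ++ s)
      ≡⟨ ∑-congᴬ (All.map split-sum (words-length j)) ⟩
    ∑[ w ∈ words j ] (𝟙 (counted? p (n ∸ a) (m ∸ c) w) * 1)
      ≡⟨ ∑-cong (words j) (λ w → *-identityʳ _) ⟩
    count p (n ∸ a) (m ∸ c)
      ∎
    where
    j = (n ∸ a) + (m ∸ c)
    E = λ v → 𝟙 (endsWithPattern? n m v)
    n+m≡j+|p| : n + m ≡ j + length p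
    n+m≡j+|p| = begin
      n + m                           ≡⟨ cong₂ _+_ (m∸n+n≡m a≤n) (m∸n+n≡m c≤m) ⟨
      (n ∸ a) + a + ((m ∸ c) + c)     ≡⟨ regroup (n ∸ a) a (m ∸ c) c ⟩
      j + (a + c)                     ≡⟨ cong (λ k → j + k) (length≡#r+#u p) ⟨
      j + length p                    ∎
      where
      regroup : ∀ x y z w → x + y + (z + w) ≡ x + z + (y + w)
      regroup = ℕ-Solver.solve-∀
    ends⇔ : ∀ w s → length w ≡ j → EndsWithPattern n m (w ++ s) → Counted p (n ∸ a) (m ∸ c) w × s ≡ p
    ends⇔ w s |w|≡j (_ , w′ , ws≡w′p , counted@(_ , (#r≡ , #u≡) , _))
      with ++-length-injective {w} {w′} {s} {p} (trans |w|≡j (sym (trans (length≡#r+#u w′) (cong₂ _+_ #r≡ #u≡)))) ws≡w′p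
    ... | refl , s≡p = counted , s≡p
    split-sum : ∀ {w} → length w ≡ j → ∑[ s ∈ words (length p) ] E (w ++ s) ≡ 𝟙 (counted? p (n ∸ a) (m ∸ c) w) * 1
    split-sum {w} |w|≡j = begin
      ∑[ s ∈ words (length p) ] E (w ++ s)
        ≡⟨ ∑-cong (words (length p)) (λ s → trans
             (𝟙-cong (endsWithPattern? n m (w ++ s)) (counted? p (n ∸ a) (m ∸ c) w ×-dec (s ≟W p))
               (ends⇔ w s |w|≡j) (λ { (counted , refl) → a≤n , w , refl , counted }))
             (𝟙-× (counted? p (n ∸ a) (m ∸ c) w) (s ≟W p))) ⟩
      ∑[ s ∈ words (length p) ] (𝟙 (counted? p (n ∸ a) (m ∸ c) w) * 𝟙 (s ≟W p))
        ≡⟨ *-distribˡ-∑ (𝟙 (counted? p (n ∸ a) (m ∸ c) w)) (words (length p)) (λ s → 𝟙 (s ≟W p)) ⟩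
      𝟙 (counted? p (n ∸ a) (m ∸ c) w) * ∑[ s ∈ words (length p) ] 𝟙 (s ≟W p)
        ≡⟨ cong (𝟙 (counted? p (n ∸ a) (m ∸ c) w) *_) (∑-words-≡ p) ⟩
      𝟙 (counted? p (n ∸ a) (m ∸ c) w) * 1
        ∎

  private
    f : ℕ → ℕ → ℚ
    f n m = ιₙ (count p n m)

    beforePattern≡endsCount : ∀ n m → n ≤ m → beforePattern a c f n m ≡ ιₙ (endsCount n m)
    beforePattern≡endsCount n m n≤m = by-room (a ≤? n)
      where
      by-room : Dec (a ≤ n) → beforePattern a c f n m ≡ ιₙ (endsCount n m)
      by-room (yes a≤n) = trans (beforePattern-room a≤n)
                            (cong ιₙ (sym (endsCount-room {n} {m} a≤n (≤-trans c≤a (≤-trans a≤n n≤m)))))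
      by-room (no  a≰n) = trans (beforePattern-no-room a≰n) (cong ιₙ (sym (endsCount-no-room {n} {m} a≰n)))

    left≡∑ : ∀ n m → left f n (suc m) ≡ ιₙ (∑[ w ∈ words (n + m) ] 𝟙 (countedBefore? r n (suc m) w))
    left≡∑ zero    m = cong ιₙ (sym (∑-zero (words m) (λ _ → refl)))
    left≡∑ (suc n) m = cong (λ k → ιₙ (∑[ w ∈ words k ] 𝟙 (counted? p n (suc m) w))) (+-suc n m)

  count-recurrence : Recurrence a c f
  count-recurrence = record
    { at-origin      = cong (λ k → ιₙ (k + 0)) (𝟙-yes (counted? p 0 0 []) counted-[])
    ; below-diagonal = λ m → cong ιₙ (∑-zero (words (suc m + m)) λ v →
                         𝟙-no (counted? p (suc m) m v) λ (bal , (#r≡ , #u≡) , _) →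
                           <-irrefl refl (subst₂ _≤_ #r≡ #u≡ (ballot-endpoint bal)))
    ; step           = step
    }
    where
    counted-[] : Counted p 0 0 []
    counted-[] = ≤-refl ∷ [] , (refl , refl) , subst (λ p′ → Avoids p′ []) (sym p≡q₀x₀) (∷ʳ-∉-[] q₀ x₀)
    step : ∀ n m → n ≤ suc m → f n (suc m) Q.+ beforePattern a c f n (suc m) ≡ f n m Q.+ left f n (suc m)
    step n m n≤1+m = begin
      f n (suc m) Q.+ beforePattern a c f n (suc m)
        ≡⟨ cong (f n (suc m) Q.+_) (beforePattern≡endsCount n (suc m) n≤1+m) ⟩
      ιₙ (count p n (suc m)) Q.+ ιₙ (endsCount n (suc m))
        ≡⟨ ιₙ-+ (count p n (suc m)) (endsCount n (suc m)) ⟨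
      ιₙ (count p n (suc m) + endsCount n (suc m))
        ≡⟨ cong ιₙ (count-step n m n≤1+m) ⟩
      ιₙ (count p n m + ∑[ w ∈ words (n + m) ] 𝟙 (countedBefore? r n (suc m) w))
        ≡⟨ ιₙ-+ (count p n m) (∑[ w ∈ words (n + m) ] 𝟙 (countedBefore? r n (suc m) w)) ⟩
      f n m Q.+ ιₙ (∑[ w ∈ words (n + m) ] 𝟙 (countedBefore? r n (suc m) w))
        ≡⟨ cong (f n m Q.+_) (left≡∑ n m) ⟨
      f n m Q.+ left f n (suc m)
        ∎

sFormula-diagonal : ∀ a c n → sFormula a c n n ≡ dyckFormula a c n
sFormula-diagonal a c n = trans (cong (λ z → ι z Q.* S) (+m-+n+1≡+P {n} {n} {1} (+-comm n 1))) (QP.*-identityˡ S)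
  where S = sumTo (floorDiv n (a ∸ 1)) (summand a c n (+ n) (+ (n + n)))

∷ʳ-view : ∀ p → 1 ≤ #r p → ∃[ q ] ∃[ x ] p ≡ q ∷ʳ x
∷ʳ-view p 1≤#r with initLast p
... | []     = contradiction 1≤#r λ ()
... | q ∷ʳ′ x = q , x , refl

mainTheorem4 : (p : Word) → DepthZero p → BifixFree p → 2 ≤ #r p →
    ((n m : ℕ) → n ≤ m → (+ s p n m) / 1 ≡ sFormula (#r p) (#u p) n m)
    × ((n : ℕ) → (+ s p n n) / 1 ≡ dyckFormula (#r p) (#u p) n)
mainTheorem4 p dz bf 2≤a = paths≡formula , λ n → trans (paths≡formula n n ≤-refl) (sFormula-diagonal a c n)
  where
  1≤a : 1 ≤ #r p
  1≤a = ≤-trans (s≤s z≤n) 2≤a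
  view : ∃[ q ] ∃[ x ] p ≡ q ∷ʳ x
  view = ∷ʳ-view p 1≤a
  open PathCounting p dz bf (proj₁ view) (proj₁ (proj₂ view)) (proj₂ (proj₂ view))
  paths≡formula : ∀ n m → n ≤ m → ιₙ (s p n m) ≡ sFormula a c n m
  paths≡formula n m n≤m = trans (cong ιₙ (s≡count p n m))
    (Recurrence-unique 1≤a c≤a count-recurrence (sFormula-recurrence 2≤a c≤a) n≤m)
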